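{- For integers $n,m$ and $y=(y_1,y_2,y_3)\in\mathbb{Z}^3$ with $y_1+y_2+y_3=0$, \[ \sum_{r=y_1}^n \sum_{s=y_1+y_2}^m \mathcal{K}_{n,m;r,s}(z,w;q)\,\Phi_{r,s;y}(z,w;q)= z^{y_1}w^{y_1+y_2}q^{\frac{1}{2}(y_1^2+y_2^2+y_3^2)}\,\Phi_{n,m;y}(z,w;q). \]
   Context: $z,w,q$ are indeterminates; $(a;q)_\infty=\prod_{j\geq0}(1-aq^j)$ and $(a;q)_n=(a;q)_\infty/(aq^n;q)_\infty$ for all $n\in\mathbb{Z}$ (so $1/(q;q)_n=0$ for $n<0$). For $y\in\mathbb{Z}^3$ with $y_1+y_2+y_3=0$ and $n,m\in\mathbb{Z}$, \[ \Phi_{n,m;y}(z,w;q):=\frac{(zwq;q)_{n+m}}{(q;q)_{n-y_1}(zq;q)_{n-y_2}(zwq;q)_{n-y_3}(q;q)_{m+y_3}(wq;q)_{m+y_2}(zwq;q)_{m+y_1}}, \] and $\mathcal{K}_{n,m;r,s}(z,w;q):=\frac{z^rw^sq^{r^2-rs+s^2}}{(q;q)_{n-r}(q;q)_{m-s}}$. -}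

module Defs where

open import Level using (Level; _⊔_) renaming (suc to lsuc)
open import Algebra.Bundles using (CommutativeRing)
open import Relation.Nullary using (¬_)
open import Data.Nat as ℕ using (ℕ; zero; suc)
open import Data.Integer as ℤ using (ℤ; +_; -[1+_]; ∣_∣)

record Field (c ℓ : Level) : Set (lsuc (c ⊔ ℓ)) where
  field
    commutativeRing : CommutativeRing c ℓ
  open CommutativeRing commutativeRing public
  field
    _⁻¹        : Carrier → Carrier
    ⁻¹-inverse : ∀ x → ¬ (x ≈ 0#) → x * (x ⁻¹) ≈ 1#
    0≉1        : ¬ (0# ≈ 1#)

module QSeries {c ℓ : Level} (F : Field c ℓ) (z w q : Field.Carrier F) where
  open Field F using (Carrier; _≈_; 0#; 1#; _+_; _*_; _-_; _⁻¹)

  _^ℕ_ : Carrier → ℕ → Carrier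
  x ^ℕ zero    = 1#
  x ^ℕ (suc n) = x * (x ^ℕ n)

  _^ℤ_ : Carrier → ℤ → Carrier
  x ^ℤ (+ n)      = x ^ℕ n
  x ^ℤ (-[1+ n ]) = (x ⁻¹) ^ℕ (suc n)

  pochℕ : Carrier → ℕ → Carrier
  pochℕ a zero    = 1#
  pochℕ a (suc k) = pochℕ a k * (1# - a * (q ^ℕ k))

  -- (a;q)_n for n ∈ ℤ, i.e. (a;q)_∞/(aq^n;q)_∞:
  --   (a;q)_N      = ∏_{j<N} (1 - a q^j)
  --   (a;q)_{-N}   = 1 / (a q^{-N};q)_N
  poch : Carrier → ℤ → Carrier
  poch a (+ n)      = pochℕ a n
  poch a (-[1+ n ]) = (pochℕ (a * (q ^ℤ -[1+ n ])) (suc n)) ⁻¹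

  -- 1/(a;q)_n for n ∈ ℤ (written without dividing by zero: for n = -N
  -- it is the polynomial (a q^{-N};q)_N; in particular 1/(q;q)_n = 0 for n < 0).
  recipPoch : Carrier → ℤ → Carrier
  recipPoch a (+ n)      = (pochℕ a n) ⁻¹
  recipPoch a (-[1+ n ]) = pochℕ (a * (q ^ℤ -[1+ n ])) (suc n)

  Φ : ℤ → ℤ → ℤ → ℤ → ℤ → Carrier
  Φ n m y₁ y₂ y₃ =
    poch (z * w * q) (n ℤ.+ m)
    * recipPoch q (n ℤ.- y₁)
    * recipPoch (z * q) (n ℤ.- y₂)
    * recipPoch (z * w * q) (n ℤ.- y₃)
    * recipPoch q (m ℤ.+ y₃)
    * recipPoch (w * q) (m ℤ.+ y₂)
    * recipPoch (z * w * q) (m ℤ.+ y₁)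

  𝒦 : ℤ → ℤ → ℤ → ℤ → Carrier
  𝒦 n m r s =
    (z ^ℤ r) * (w ^ℤ s) * (q ^ℤ (r ℤ.* r ℤ.- r ℤ.* s ℤ.+ s ℤ.* s))
    * recipPoch q (n ℤ.- r)
    * recipPoch q (m ℤ.- s)

  sumFrom : (ℤ → Carrier) → ℤ → ℕ → Carrier
  sumFrom f a zero      = 0#
  sumFrom f a (suc len) = f a + sumFrom f (a ℤ.+ + 1) len

  rangeLength : ℤ → ℤ → ℕ
  rangeLength a b with b ℤ.- a
  ... | + k      = suc k
  ... | -[1+ _ ] = zero

  sumRange : ℤ → ℤ → (ℤ → Carrier) → Carrier
  sumRange a b f = sumFrom f a (rangeLength a b)

  -- q^{(y₁²+y₂²+y₃²)/2}; the sum of squares is even when y₁+y₂+y₃ = 0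
  halfSqExp : ℤ → ℤ → ℤ → ℕ
  halfSqExp y₁ y₂ y₃ = ∣ y₁ ℤ.* y₁ ℤ.+ y₂ ℤ.* y₂ ℤ.+ y₃ ℤ.* y₃ ∣ ℕ./ 2

-- Put N = n - y₁, M = m - y₁ - y₂ (if either is negative, both sides vanish because of the
-- factors 1/(q;q)_{n-y₁} and 1/(q;q)_{m+y₃} of Φ), r = y₁ + a, s = y₁ + y₂ + b, and
-- Z = z q^{y₁-y₂}, W = w q^{y₁+2y₂}, x = ZWq. Shifting the integer Pochhammer symbols of
-- Φ_{r,s;y} to those of Φ_{n,m;y} pulls out a common factor, and the identity becomes
--   Σ_{a≤N, b≤M} [N a][M b] Z^a W^b q^{a²-ab+b²} (x)_{a+b} (Zq^{a+1})_{N-a} (xq^a)_{N-a}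
--                                                 (Wq^{b+1})_{M-b} (xq^b)_{M-b} = (x)_{N+M}.
-- Write (x)_{a+b} = (x)_b (xq^b)_a and expand (xq^b)_a by a q-Vandermonde sum over k.
-- After exchanging sums, the sums over a - k and b - k are instances of
--   Σ_i [L i] X^i q^{i²} (Xq^{i+1})_{L-i} = 1,
-- and the remaining sum over k is a q-binomial expansion of (ZWq^{M+1})_N, which together
-- with (x)_M gives (x)_{N+M}. These three single-sum identities follow by induction on the
-- length from the two q-Pascal rules.

module Submission where

open import Defs
open import Level using (Level)
open import Relation.Nullary using (¬_; yes; no)
open import Relation.Binary.PropositionalEquality as P using (_≡_)
open import Data.Integer as ℤ using (ℤ; +_; -[1+_]; ∣_∣; sign; _◃_)
open import Data.Nat as ℕ using (ℕ; zero; suc)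
open import Data.Maybe using (Maybe; just; nothing)
open import Data.Sum using (inj₁; inj₂)
open import Relation.Binary.Definitions using (tri<; tri≈; tri>)
open import Data.Sign as Sign using (Sign)
open import Function.Base using (_⟨_⟩_)
open import Algebra.Solver.Ring.AlmostCommutativeRing
  using (fromCommutativeRing; _-Raw-AlmostCommutative⟶_)
import Data.Integer.Properties as ℤ
import Data.Nat.Properties as ℕ
import Data.Nat.DivMod as ℕ
import Data.Sign.Properties as Sign
open import Data.Nat.Tactic.RingSolver using (solve-∀)
import Data.Integer.Tactic.RingSolver as ZS

module FieldProperties {c ℓ : Level} (F : Field c ℓ) where
  open Field F hiding (zero)
  open import Relation.Binary.Reasoning.Setoid setoid public
  open import Algebra.Properties.Semiring.Mult.TCOptimised semiring using (_×_; ×-homo-+; ×1-homo-*)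
  open import Algebra.Properties.Ring ring using (-‿distribˡ-*; -‿distribʳ-*)
  open import Algebra.Properties.Group +-group using (ε⁻¹≈ε) renaming (⁻¹-involutive to -‿involutive)
  open import Algebra.Properties.AbelianGroup +-abelianGroup using (⁻¹-∙-comm)
  open import Algebra.Properties.CommutativeSemigroup *-commutativeSemigroup using (interchange)
  open import Algebra.Properties.CommutativeSemigroup +-commutativeSemigroup using ()
    renaming (interchange to interchange⁺)

  fromSign : Sign → Carrier
  fromSign Sign.+ = 1#
  fromSign Sign.- = - 1#

  fromℤ : ℤ → Carrier
  fromℤ (+ n)    = n × 1#
  fromℤ -[1+ n ] = - (suc n × 1#)

  fromSign-homo-* : ∀ s t → fromSign (s Sign.* t) ≈ fromSign s * fromSign t
  fromSign-homo-* Sign.+ t      = sym (*-identityˡ _)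
  fromSign-homo-* Sign.- Sign.+ = sym (*-identityʳ _)
  fromSign-homo-* Sign.- Sign.- = begin
    1#            ≈⟨ -‿involutive 1# ⟨
    - - 1#        ≈⟨ -‿cong (*-identityʳ (- 1#)) ⟨
    - (- 1# * 1#) ≈⟨ -‿distribʳ-* _ _ ⟩
    - 1# * - 1#   ∎

  fromℤ-◃ : ∀ s n → fromℤ (s ◃ n) ≈ fromSign s * (n × 1#)
  fromℤ-◃ s      zero    = sym (zeroʳ _)
  fromℤ-◃ Sign.+ (suc n) = sym (*-identityˡ _)
  fromℤ-◃ Sign.- (suc n) = -‿cong (sym (*-identityˡ _)) ⟨ trans ⟩ -‿distribˡ-* _ _

  fromℤ-sign : ∀ i → fromℤ i ≈ fromSign (sign i) * (∣ i ∣ × 1#)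
  fromℤ-sign i = reflexive (P.cong fromℤ (P.sym (ℤ.◃-inverse i))) ⟨ trans ⟩ fromℤ-◃ (sign i) ∣ i ∣

  fromℤ-homo-* : ∀ i j → fromℤ (i ℤ.* j) ≈ fromℤ i * fromℤ j
  fromℤ-homo-* i j = begin
    fromℤ (i ℤ.* j)
      ≈⟨ fromℤ-◃ (sign i Sign.* sign j) (∣ i ∣ ℕ.* ∣ j ∣) ⟩
    fromSign (sign i Sign.* sign j) * ((∣ i ∣ ℕ.* ∣ j ∣) × 1#)
      ≈⟨ *-cong (fromSign-homo-* (sign i) (sign j)) (×1-homo-* ∣ i ∣ ∣ j ∣) ⟩
    (fromSign (sign i) * fromSign (sign j)) * ((∣ i ∣ × 1#) * (∣ j ∣ × 1#))
      ≈⟨ interchange _ _ _ _ ⟩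
    (fromSign (sign i) * (∣ i ∣ × 1#)) * (fromSign (sign j) * (∣ j ∣ × 1#))
      ≈⟨ *-cong (fromℤ-sign i) (fromℤ-sign j) ⟨
    fromℤ i * fromℤ j ∎

  fromℤ-homo-neg : ∀ i → fromℤ (ℤ.- i) ≈ - fromℤ i
  fromℤ-homo-neg -[1+ n ]    = sym (-‿involutive _)
  fromℤ-homo-neg (+ zero)    = sym ε⁻¹≈ε
  fromℤ-homo-neg (+ (suc n)) = refl

  x-0≈x : ∀ x → x - 0# ≈ x
  x-0≈x x = +-congˡ ε⁻¹≈ε ⟨ trans ⟩ +-identityʳ x

  [1+x]-[1+y]≈x-y : ∀ x y → (1# + x) - (1# + y) ≈ x - y
  [1+x]-[1+y]≈x-y x y = begin
    (1# + x) - (1# + y)     ≈⟨ +-congˡ (⁻¹-∙-comm 1# y) ⟨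
    (1# + x) + (- 1# + - y) ≈⟨ interchange⁺ 1# x (- 1#) (- y) ⟩
    (1# - 1#) + (x - y)     ≈⟨ +-congʳ (-‿inverseʳ 1#) ⟩
    0# + (x - y)            ≈⟨ +-identityˡ _ ⟩
    x - y                   ∎

  fromℤ-⊖ : ∀ m n → fromℤ (m ℤ.⊖ n) ≈ m × 1# - n × 1#
  fromℤ-⊖ m       zero    = reflexive (P.cong fromℤ (ℤ.⊖-≥ {m} ℕ.z≤n)) ⟨ trans ⟩ sym (x-0≈x _)
  fromℤ-⊖ zero    (suc n) = begin
    fromℤ (0 ℤ.⊖ suc n)          ≡⟨ P.cong fromℤ (ℤ.⊖-swap 0 (suc n)) ⟩
    fromℤ (ℤ.- (suc n ℤ.⊖ 0))    ≈⟨ fromℤ-homo-neg (suc n ℤ.⊖ 0) ⟩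
    - fromℤ (suc n ℤ.⊖ 0)        ≈⟨ -‿cong (fromℤ-⊖ (suc n) 0 ⟨ trans ⟩ x-0≈x _) ⟩
    - (suc n × 1#)               ≈⟨ +-identityˡ _ ⟨
    0# - suc n × 1#              ∎
  fromℤ-⊖ (suc m) (suc n) = begin
    fromℤ (suc m ℤ.⊖ suc n)      ≡⟨ P.cong fromℤ (ℤ.[1+m]⊖[1+n]≡m⊖n m n) ⟩
    fromℤ (m ℤ.⊖ n)              ≈⟨ fromℤ-⊖ m n ⟩
    m × 1# - n × 1#              ≈⟨ [1+x]-[1+y]≈x-y _ _ ⟨
    (1# + m × 1#) - (1# + n × 1#) ≈⟨ +-cong (×-homo-+ 1# 1 m) (-‿cong (×-homo-+ 1# 1 n)) ⟨
    suc m × 1# - suc n × 1#      ∎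

  fromℤ-homo-+ : ∀ i j → fromℤ (i ℤ.+ j) ≈ fromℤ i + fromℤ j
  fromℤ-homo-+ (+ m)    (+ n)    = ×-homo-+ 1# m n
  fromℤ-homo-+ (+ m)    -[1+ n ] = fromℤ-⊖ m (suc n)
  fromℤ-homo-+ -[1+ m ] (+ n)    = fromℤ-⊖ n (suc m) ⟨ trans ⟩ +-comm _ _
  fromℤ-homo-+ -[1+ m ] -[1+ n ] = begin
    - (suc (suc (m ℕ.+ n)) × 1#)        ≡⟨ P.cong (λ k → - (suc k × 1#)) (ℕ.+-suc m n) ⟨
    - ((suc m ℕ.+ suc n) × 1#)          ≈⟨ -‿cong (×-homo-+ 1# (suc m) (suc n)) ⟩
    - (suc m × 1# + suc n × 1#)         ≈⟨ ⁻¹-∙-comm _ _ ⟨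
    - (suc m × 1#) + - (suc n × 1#)     ∎

  ℤ-homomorphism : ℤ.+-*-rawRing -Raw-AlmostCommutative⟶ fromCommutativeRing commutativeRing
  ℤ-homomorphism = record
    { ⟦_⟧ = fromℤ ; +-homo = fromℤ-homo-+ ; *-homo = fromℤ-homo-* ; -‿homo = fromℤ-homo-neg
    ; 0-homo = refl ; 1-homo = refl }

  ≡⇒fromℤ≈ : ∀ i j → Maybe (fromℤ i ≈ fromℤ j)
  ≡⇒fromℤ≈ i j with i ℤ.≟ j
  ... | yes P.refl = just refl
  ... | no _       = nothing

  open import Algebra.Solver.Ring ℤ.+-*-rawRing (fromCommutativeRing commutativeRing) ℤ-homomorphism ≡⇒fromℤ≈ public

  NonZero : Carrier → Set ℓ
  NonZero x = ¬ (x ≈ 0#)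

  x≈0⇒x*y≈0 : ∀ {x} y → x ≈ 0# → x * y ≈ 0#
  x≈0⇒x*y≈0 y x≈0 = *-congʳ x≈0 ⟨ trans ⟩ zeroˡ y

  y≈0⇒x*y≈0 : ∀ x {y} → y ≈ 0# → x * y ≈ 0#
  y≈0⇒x*y≈0 x y≈0 = *-congˡ y≈0 ⟨ trans ⟩ zeroʳ x

  ⁻¹-inverseˡ : ∀ {x} → NonZero x → x ⁻¹ * x ≈ 1#
  ⁻¹-inverseˡ {x} x≉0 = *-comm _ _ ⟨ trans ⟩ ⁻¹-inverse x x≉0

  ⁻¹-unique : ∀ {x a} → NonZero x → x * a ≈ 1# → a ≈ x ⁻¹
  ⁻¹-unique {x} {a} x≉0 xa≈1 = begin
    a              ≈⟨ *-identityˡ a ⟨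
    1# * a         ≈⟨ *-congʳ (⁻¹-inverseˡ x≉0) ⟨
    x ⁻¹ * x * a   ≈⟨ *-assoc _ _ _ ⟩
    x ⁻¹ * (x * a) ≈⟨ *-congˡ xa≈1 ⟩
    x ⁻¹ * 1#      ≈⟨ *-identityʳ _ ⟩
    x ⁻¹           ∎

  nonZero-resp : ∀ {x y} → x ≈ y → NonZero x → NonZero y
  nonZero-resp x≈y x≉0 y≈0 = x≉0 (trans x≈y y≈0)

  1-nonZero : NonZero 1#
  1-nonZero 1≈0 = 0≉1 (sym 1≈0)

  *-nonZero : ∀ {x y} → NonZero x → NonZero y → NonZero (x * y)
  *-nonZero {x} {y} x≉0 y≉0 xy≈0 = y≉0 (begin
    y              ≈⟨ *-identityˡ y ⟨
    1# * y         ≈⟨ *-congʳ (⁻¹-inverseˡ x≉0) ⟨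
    x ⁻¹ * x * y   ≈⟨ *-assoc _ _ _ ⟩
    x ⁻¹ * (x * y) ≈⟨ y≈0⇒x*y≈0 _ xy≈0 ⟩
    0#             ∎)

  ⁻¹-nonZero : ∀ {x} → NonZero x → NonZero (x ⁻¹)
  ⁻¹-nonZero {x} x≉0 x⁻¹≈0 = 0≉1 (sym (sym (⁻¹-inverse x x≉0) ⟨ trans ⟩ y≈0⇒x*y≈0 x x⁻¹≈0))

  ⁻¹-involutive : ∀ {x} → NonZero x → (x ⁻¹) ⁻¹ ≈ x
  ⁻¹-involutive x≉0 = sym (⁻¹-unique (⁻¹-nonZero x≉0) (⁻¹-inverseˡ x≉0))

  ⁻¹-cong : ∀ {x y} → NonZero x → x ≈ y → x ⁻¹ ≈ y ⁻¹
  ⁻¹-cong x≉0 x≈y = ⁻¹-unique (nonZero-resp x≈y x≉0) (*-congʳ (sym x≈y) ⟨ trans ⟩ ⁻¹-inverse _ x≉0)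

  1⁻¹≈1 : 1# ⁻¹ ≈ 1#
  1⁻¹≈1 = sym (⁻¹-unique 1-nonZero (*-identityˡ _))

  ⁻¹-distrib-* : ∀ {x y} → NonZero x → NonZero y → (x * y) ⁻¹ ≈ x ⁻¹ * y ⁻¹
  ⁻¹-distrib-* {x} {y} x≉0 y≉0 = sym (⁻¹-unique (*-nonZero x≉0 y≉0) (begin
    (x * y) * (x ⁻¹ * y ⁻¹)   ≈⟨ interchange _ _ _ _ ⟩
    (x * x ⁻¹) * (y * y ⁻¹)   ≈⟨ *-cong (⁻¹-inverse x x≉0) (⁻¹-inverse y y≉0) ⟩
    1# * 1#                   ≈⟨ *-identityˡ _ ⟩
    1#                        ∎))

  ∑< : ℕ → (ℕ → Carrier) → Carrier
  ∑< zero    f = 0#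
  ∑< (suc n) f = f 0 + ∑< n (λ i → f (suc i))

  ∑-cong : ∀ {f g} n → (∀ i → i ℕ.< n → f i ≈ g i) → ∑< n f ≈ ∑< n g
  ∑-cong zero    f≈g = refl
  ∑-cong (suc n) f≈g = +-cong (f≈g 0 (ℕ.s≤s ℕ.z≤n)) (∑-cong n (λ i i<n → f≈g (suc i) (ℕ.s≤s i<n)))

  ∑-zero : ∀ {f} n → (∀ i → i ℕ.< n → f i ≈ 0#) → ∑< n f ≈ 0#
  ∑-zero zero    f≈0 = refl
  ∑-zero (suc n) f≈0 = +-cong (f≈0 0 (ℕ.s≤s ℕ.z≤n)) (∑-zero n (λ i i<n → f≈0 (suc i) (ℕ.s≤s i<n))) ⟨ trans ⟩ +-identityˡ _

  ∑-distrib-+ : ∀ f g n → ∑< n (λ i → f i + g i) ≈ ∑< n f + ∑< n g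
  ∑-distrib-+ f g zero    = sym (+-identityˡ _)
  ∑-distrib-+ f g (suc n) = +-congˡ (∑-distrib-+ _ _ n) ⟨ trans ⟩ interchange⁺ _ _ _ _

  *-distribˡ-∑ : ∀ a f n → a * ∑< n f ≈ ∑< n (λ i → a * f i)
  *-distribˡ-∑ a f zero    = zeroʳ a
  *-distribˡ-∑ a f (suc n) = distribˡ _ _ _ ⟨ trans ⟩ +-congˡ (*-distribˡ-∑ a _ n)

  ∑-+ : ∀ f k m → ∑< (k ℕ.+ m) f ≈ ∑< k f + ∑< m (λ i → f (k ℕ.+ i))
  ∑-+ f zero    m = sym (+-identityˡ _)
  ∑-+ f (suc k) m = +-congˡ (∑-+ _ k m) ⟨ trans ⟩ sym (+-assoc _ _ _)

  ∑-comm : ∀ (f : ℕ → ℕ → Carrier) n m → ∑< n (λ i → ∑< m (λ j → f i j)) ≈ ∑< m (λ j → ∑< n (λ i → f i j))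
  ∑-comm f zero    m = sym (∑-zero m (λ _ _ → refl))
  ∑-comm f (suc n) m = +-congˡ (∑-comm _ n m) ⟨ trans ⟩ sym (∑-distrib-+ _ _ m)

  ∑-dropInitialZeros : ∀ f k n → k ℕ.≤ n → (∀ i → i ℕ.< k → f i ≈ 0#) →
                       ∑< n f ≈ ∑< (n ℕ.∸ k) (λ i → f (k ℕ.+ i))
  ∑-dropInitialZeros f k n k≤n f≈0 = begin
    ∑< n f                                       ≡⟨ P.cong (λ l → ∑< l f) (ℕ.m+[n∸m]≡n k≤n) ⟨
    ∑< (k ℕ.+ (n ℕ.∸ k)) f                       ≈⟨ ∑-+ f k _ ⟩
    ∑< k f + ∑< (n ℕ.∸ k) (λ i → f (k ℕ.+ i))        ≈⟨ +-congʳ (∑-zero k f≈0) ⟩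
    0# + ∑< (n ℕ.∸ k) (λ i → f (k ℕ.+ i))            ≈⟨ +-identityˡ _ ⟩
    ∑< (n ℕ.∸ k) (λ i → f (k ℕ.+ i))                 ∎

  ∑-dropFinalZeros : ∀ f k n → k ℕ.≤ n → (∀ i → k ℕ.≤ i → i ℕ.< n → f i ≈ 0#) → ∑< n f ≈ ∑< k f
  ∑-dropFinalZeros f k n k≤n f≈0 = begin
    ∑< n f                                       ≡⟨ P.cong (λ l → ∑< l f) (ℕ.m+[n∸m]≡n k≤n) ⟨
    ∑< (k ℕ.+ (n ℕ.∸ k)) f                       ≈⟨ ∑-+ f k _ ⟩
    ∑< k f + ∑< (n ℕ.∸ k) (λ i → f (k ℕ.+ i))        ≈⟨ +-congˡ (∑-zero _ tail≈0) ⟩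
    ∑< k f + 0#                                  ≈⟨ +-identityʳ _ ⟩
    ∑< k f                                       ∎
    where
    tail≈0 : ∀ i → i ℕ.< n ℕ.∸ k → f (k ℕ.+ i) ≈ 0#
    tail≈0 i i<n-k = f≈0 (k ℕ.+ i) (ℕ.m≤m+n k i) (ℕ.+-monoʳ-< k i<n-k ⟨ ℕ.<-≤-trans ⟩ ℕ.≤-reflexive (ℕ.m+[n∸m]≡n k≤n))

module Powers {c ℓ : Level} (F : Field c ℓ) (z w q : Field.Carrier F) where
  open Field F hiding (zero)
  open QSeries F z w q
  open FieldProperties F

  ^ℕ-congʳ : ∀ x {m n} → m ≡ n → x ^ℕ m ≈ x ^ℕ n
  ^ℕ-congʳ x P.refl = refl

  ^ℕ-homo-+ : ∀ x m n → x ^ℕ (m ℕ.+ n) ≈ x ^ℕ m * x ^ℕ n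
  ^ℕ-homo-+ x zero    n = sym (*-identityˡ _)
  ^ℕ-homo-+ x (suc m) n = *-congˡ (^ℕ-homo-+ x m n) ⟨ trans ⟩ sym (*-assoc _ _ _)

  ^ℕ-split : ∀ x {k n} → k ℕ.≤ n → x ^ℕ n ≈ x ^ℕ k * x ^ℕ (n ℕ.∸ k)
  ^ℕ-split x {k} {n} k≤n = ^ℕ-congʳ x (P.sym (ℕ.m+[n∸m]≡n k≤n)) ⟨ trans ⟩ ^ℕ-homo-+ x k (n ℕ.∸ k)

  ^ℕ-distrib-* : ∀ x y n → (x * y) ^ℕ n ≈ x ^ℕ n * y ^ℕ n
  ^ℕ-distrib-* x y zero    = sym (*-identityˡ _)
  ^ℕ-distrib-* x y (suc n) = *-congˡ (^ℕ-distrib-* x y n) ⟨ trans ⟩ interchange x y _ _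
    where open import Algebra.Properties.CommutativeSemigroup *-commutativeSemigroup using (interchange)

  ^ℕ-assocʳ : ∀ x m n → (x ^ℕ m) ^ℕ n ≈ x ^ℕ (m ℕ.* n)
  ^ℕ-assocʳ x m zero    = ^ℕ-congʳ x (P.sym (ℕ.*-zeroʳ m))
  ^ℕ-assocʳ x m (suc n) = begin
    x ^ℕ m * (x ^ℕ m) ^ℕ n   ≈⟨ *-congˡ (^ℕ-assocʳ x m n) ⟩
    x ^ℕ m * x ^ℕ (m ℕ.* n)  ≈⟨ ^ℕ-homo-+ x m (m ℕ.* n) ⟨
    x ^ℕ (m ℕ.+ m ℕ.* n)     ≡⟨ P.cong (x ^ℕ_) (ℕ.*-suc m n) ⟨
    x ^ℕ (m ℕ.* suc n)       ∎

  ^ℤ-congʳ : ∀ x {i j} → i ≡ j → x ^ℤ i ≈ x ^ℤ j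
  ^ℤ-congʳ x P.refl = refl

  module _ {x : Carrier} (x≉0 : NonZero x) where

    ^ℤ-⊖ : ∀ m n → x ^ℤ (m ℤ.⊖ n) ≈ x ^ℕ m * (x ⁻¹) ^ℕ n
    ^ℤ-⊖ m       zero    = ^ℤ-congʳ x (ℤ.⊖-≥ {m} ℕ.z≤n) ⟨ trans ⟩ sym (*-identityʳ _)
    ^ℤ-⊖ zero    (suc n) = sym (*-identityˡ _)
    ^ℤ-⊖ (suc m) (suc n) = begin
      x ^ℤ (suc m ℤ.⊖ suc n)                 ≈⟨ ^ℤ-congʳ x (ℤ.[1+m]⊖[1+n]≡m⊖n m n) ⟩
      x ^ℤ (m ℤ.⊖ n)                         ≈⟨ ^ℤ-⊖ m n ⟩
      x ^ℕ m * (x ⁻¹) ^ℕ n                   ≈⟨ *-identityˡ _ ⟨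
      1# * (x ^ℕ m * (x ⁻¹) ^ℕ n)            ≈⟨ *-congʳ (⁻¹-inverse x x≉0) ⟨
      (x * x ⁻¹) * (x ^ℕ m * (x ⁻¹) ^ℕ n)    ≈⟨ solve 4 (λ a b c d → (a :* b) :* (c :* d) := (a :* c) :* (b :* d)) refl x _ _ _ ⟩
      (x * x ^ℕ m) * (x ⁻¹ * (x ⁻¹) ^ℕ n)    ∎

    ^ℤ-homo-+ : ∀ i j → x ^ℤ (i ℤ.+ j) ≈ x ^ℤ i * x ^ℤ j
    ^ℤ-homo-+ (+ m)    (+ n)    = ^ℕ-homo-+ x m n
    ^ℤ-homo-+ (+ m)    -[1+ n ] = ^ℤ-⊖ m (suc n)
    ^ℤ-homo-+ -[1+ m ] (+ n)    = ^ℤ-⊖ n (suc m) ⟨ trans ⟩ *-comm _ _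
    ^ℤ-homo-+ -[1+ m ] -[1+ n ] =
      ^ℕ-congʳ (x ⁻¹) (P.cong suc (P.sym (ℕ.+-suc m n))) ⟨ trans ⟩ ^ℕ-homo-+ (x ⁻¹) (suc m) (suc n)

    ^ℤ-*-+ : ∀ a i → x ^ℤ (+ a ℤ.* i) ≈ (x ^ℤ i) ^ℕ a
    ^ℤ-*-+ zero    i = ^ℤ-congʳ x (ℤ.*-zeroˡ i)
    ^ℤ-*-+ (suc a) i = begin
      x ^ℤ (+ suc a ℤ.* i)             ≡⟨ P.cong (x ^ℤ_) (ℤ.suc-* (+ a) i) ⟩
      x ^ℤ (i ℤ.+ + a ℤ.* i)           ≈⟨ ^ℤ-homo-+ i (+ a ℤ.* i) ⟩
      x ^ℤ i * x ^ℤ (+ a ℤ.* i)        ≈⟨ *-congˡ (^ℤ-*-+ a i) ⟩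
      x ^ℤ i * (x ^ℤ i) ^ℕ a           ∎

module Pochhammer {c ℓ : Level} (F : Field c ℓ) (z w q : Field.Carrier F) where
  open Field F hiding (zero)
  open QSeries F z w q
  open FieldProperties F
  open Powers F z w q

  pochℕ-cong : ∀ {a b} n → a ≈ b → pochℕ a n ≈ pochℕ b n
  pochℕ-cong zero    a≈b = refl
  pochℕ-cong (suc n) a≈b = *-cong (pochℕ-cong n a≈b) (+-congˡ (-‿cong (*-congʳ a≈b)))

  pochℕ-+ : ∀ a m n → pochℕ a (m ℕ.+ n) ≈ pochℕ a m * pochℕ (a * q ^ℕ m) n
  pochℕ-+ a m zero    = reflexive (P.cong (pochℕ a) (ℕ.+-identityʳ m)) ⟨ trans ⟩ sym (*-identityʳ _)
  pochℕ-+ a m (suc n) = begin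
    pochℕ a (m ℕ.+ suc n)
      ≡⟨ P.cong (pochℕ a) (ℕ.+-suc m n) ⟩
    pochℕ a (m ℕ.+ n) * (1# - a * q ^ℕ (m ℕ.+ n))
      ≈⟨ *-cong (pochℕ-+ a m n) (+-congˡ (-‿cong (*-congˡ (^ℕ-homo-+ q m n)))) ⟩
    (pochℕ a m * pochℕ (a * q ^ℕ m) n) * (1# - a * (q ^ℕ m * q ^ℕ n))
      ≈⟨ solve 5 (λ A B x y u → (A :* B) :* (con (+ 1) :- x :* (y :* u)) := A :* (B :* (con (+ 1) :- (x :* y) :* u))) refl _ _ a _ _ ⟩
    pochℕ a m * pochℕ (a * q ^ℕ m) (suc n) ∎

  pochℕ-suc : ∀ a n → pochℕ a (suc n) ≈ (1# - a) * pochℕ (a * q) n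
  pochℕ-suc a n = begin
    pochℕ a (1 ℕ.+ n)                                ≈⟨ pochℕ-+ a 1 n ⟩
    (1# * (1# - a * 1#)) * pochℕ (a * (q * 1#)) n    ≈⟨ *-cong a-form (pochℕ-cong n (*-congˡ (*-identityʳ q))) ⟩
    (1# - a) * pochℕ (a * q) n                       ∎
    where
    a-form : 1# * (1# - a * 1#) ≈ 1# - a
    a-form = *-identityˡ _ ⟨ trans ⟩ +-congˡ (-‿cong (*-identityʳ a))

  pochℕ-nonZero : ∀ a n → (∀ j → NonZero (1# - a * q ^ℕ j)) → NonZero (pochℕ a n)
  pochℕ-nonZero a zero    factors≉0 = 1-nonZero
  pochℕ-nonZero a (suc n) factors≉0 = *-nonZero (pochℕ-nonZero a n factors≉0) (factors≉0 n)

  -- ∏_{j<k} (1 - q^{n-j}) = (q^{n-k+1};q)_k for k ≤ n; the exponent uses truncated subtraction, so a factor 1 - q^0 = 0 appears once k > n.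
  qFalling : ℕ → ℕ → Carrier
  qFalling n zero    = 1#
  qFalling n (suc k) = qFalling n k * (1# - q ^ℕ (n ℕ.∸ k))

  qFalling-zero : ∀ n k → n ℕ.< k → qFalling n k ≈ 0#
  qFalling-zero n (suc k) (ℕ.s≤s n≤k) with ℕ.m≤n⇒m<n∨m≡n n≤k
  ... | inj₁ n<k    = x≈0⇒x*y≈0 _ (qFalling-zero n k n<k)
  ... | inj₂ P.refl = y≈0⇒x*y≈0 _ (+-congˡ (-‿cong (^ℕ-congʳ q (ℕ.n∸n≡0 n))) ⟨ trans ⟩ -‿inverseʳ 1#)

  qFalling-suc : ∀ n k → qFalling (suc n) (suc k) ≈ (1# - q ^ℕ suc n) * qFalling n k
  qFalling-suc n zero    = *-identityˡ _ ⟨ trans ⟩ sym (*-identityʳ _)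
  qFalling-suc n (suc k) = *-congʳ (qFalling-suc n k) ⟨ trans ⟩ *-assoc _ _ _

  qFalling-+ : ∀ n k i → qFalling n (k ℕ.+ i) ≈ qFalling n k * qFalling (n ℕ.∸ k) i
  qFalling-+ n k zero    = reflexive (P.cong (qFalling n) (ℕ.+-identityʳ k)) ⟨ trans ⟩ sym (*-identityʳ _)
  qFalling-+ n k (suc i) = begin
    qFalling n (k ℕ.+ suc i)
      ≡⟨ P.cong (qFalling n) (ℕ.+-suc k i) ⟩
    qFalling n (k ℕ.+ i) * (1# - q ^ℕ (n ℕ.∸ (k ℕ.+ i)))
      ≈⟨ *-cong (qFalling-+ n k i) (+-congˡ (-‿cong (^ℕ-congʳ q (P.sym (ℕ.∸-+-assoc n k i))))) ⟩
    (qFalling n k * qFalling (n ℕ.∸ k) i) * (1# - q ^ℕ (n ℕ.∸ k ℕ.∸ i))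
      ≈⟨ *-assoc _ _ _ ⟩
    qFalling n k * qFalling (n ℕ.∸ k) (suc i) ∎

  qFalling*poch : ∀ n k → k ℕ.≤ n → qFalling n k * pochℕ q (n ℕ.∸ k) ≈ pochℕ q n
  qFalling*poch n zero    _    = *-identityˡ _
  qFalling*poch n (suc k) k<n = begin
    (qFalling n k * (1# - q ^ℕ (n ℕ.∸ k))) * pochℕ q (n ℕ.∸ suc k)
      ≈⟨ solve 3 (λ a b c → (a :* b) :* c := a :* (c :* b)) refl _ _ _ ⟩
    qFalling n k * (pochℕ q (n ℕ.∸ suc k) * (1# - q ^ℕ (n ℕ.∸ k)))
      ≡⟨ P.cong (λ l → qFalling n k * (pochℕ q (n ℕ.∸ suc k) * (1# - q ^ℕ l))) n-k≡1+n-[1+k] ⟩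
    qFalling n k * pochℕ q (suc (n ℕ.∸ suc k))
      ≡⟨ P.cong (λ l → qFalling n k * pochℕ q l) n-k≡1+n-[1+k] ⟨
    qFalling n k * pochℕ q (n ℕ.∸ k)
      ≈⟨ qFalling*poch n k (ℕ.<⇒≤ k<n) ⟩
    pochℕ q n ∎
    where
    n-k≡1+n-[1+k] : n ℕ.∸ k ≡ suc (n ℕ.∸ suc k)
    n-k≡1+n-[1+k] = ℕ.+-∸-assoc 1 k<n

module GaussianBinomial {c ℓ : Level} (F : Field c ℓ) (z w q : Field.Carrier F)
  (1-q^[1+j]≉0 : ∀ j → FieldProperties.NonZero F (Field._-_ F (Field.1# F) (QSeries._^ℕ_ F z w q q (suc j)))) where
  open Field F hiding (zero)
  open QSeries F z w q
  open FieldProperties F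
  open Powers F z w q
  open Pochhammer F z w q

  qFactorial⁻¹ : ℕ → Carrier
  qFactorial⁻¹ n = (pochℕ q n) ⁻¹

  qFactorial-nonZero : ∀ n → NonZero (pochℕ q n)
  qFactorial-nonZero n = pochℕ-nonZero q n 1-q^[1+j]≉0

  qFactorial⁻¹-inverse : ∀ n → pochℕ q n * qFactorial⁻¹ n ≈ 1#
  qFactorial⁻¹-inverse n = ⁻¹-inverse _ (qFactorial-nonZero n)

  qFactorial⁻¹-suc : ∀ n → qFactorial⁻¹ n ≈ qFactorial⁻¹ (suc n) * (1# - q ^ℕ suc n)
  qFactorial⁻¹-suc n = sym (begin
    (pochℕ q n * (1# - q ^ℕ suc n)) ⁻¹ * (1# - q ^ℕ suc n)
      ≈⟨ *-congʳ (⁻¹-distrib-* (qFactorial-nonZero n) (1-q^[1+j]≉0 n)) ⟩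
    (qFactorial⁻¹ n * (1# - q ^ℕ suc n) ⁻¹) * (1# - q ^ℕ suc n)
      ≈⟨ *-assoc _ _ _ ⟩
    qFactorial⁻¹ n * ((1# - q ^ℕ suc n) ⁻¹ * (1# - q ^ℕ suc n))
      ≈⟨ *-congˡ (⁻¹-inverseˡ (1-q^[1+j]≉0 n)) ⟩
    qFactorial⁻¹ n * 1#
      ≈⟨ *-identityʳ _ ⟩
    qFactorial⁻¹ n ∎)

  qBinomial : ℕ → ℕ → Carrier
  qBinomial n k = qFalling n k * qFactorial⁻¹ k

  qBinomial-0 : ∀ n → qBinomial n 0 ≈ 1#
  qBinomial-0 n = *-identityˡ _ ⟨ trans ⟩ 1⁻¹≈1

  qBinomial-zero : ∀ n k → n ℕ.< k → qBinomial n k ≈ 0#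
  qBinomial-zero n k n<k = x≈0⇒x*y≈0 _ (qFalling-zero n k n<k)

  private
    common : ℕ → ℕ → Carrier
    common L i = qFalling L i * qFactorial⁻¹ (suc i)

    qBinomial-suc-suc : ∀ L i → qBinomial (suc L) (suc i) ≈ (1# - q ^ℕ suc L) * common L i
    qBinomial-suc-suc L i = *-congʳ (qFalling-suc L i) ⟨ trans ⟩ *-assoc _ _ _

    qBinomial-≡-common : ∀ L i → qBinomial L i ≈ common L i * (1# - q ^ℕ suc i)
    qBinomial-≡-common L i = *-congˡ (qFactorial⁻¹-suc i) ⟨ trans ⟩ sym (*-assoc _ _ _)

    qBinomial-suc-≡-common : ∀ L i → qBinomial L (suc i) ≈ common L i * (1# - q ^ℕ (L ℕ.∸ i))
    qBinomial-suc-≡-common L i = solve 3 (λ a b c → (a :* b) :* c := (a :* c) :* b) refl _ _ _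


  qBinomial-pascal : ∀ L i → qBinomial (suc L) (suc i) ≈ qBinomial L i + q ^ℕ suc i * qBinomial L (suc i)
  qBinomial-pascal L i with ℕ.≤-<-connex i L
  ... | inj₁ i≤L = begin
    qBinomial (suc L) (suc i)
      ≈⟨ qBinomial-suc-suc L i ⟩
    (1# - q ^ℕ suc L) * common L i
      ≈⟨ *-congʳ (+-congˡ (-‿cong (^ℕ-split q (ℕ.s≤s i≤L)))) ⟩
    (1# - q ^ℕ suc i * q ^ℕ (L ℕ.∸ i)) * common L i
      ≈⟨ solve 3 (λ a b c → (con (+ 1) :- a :* b) :* c := c :* (con (+ 1) :- a) :+ a :* (c :* (con (+ 1) :- b))) refl _ _ _ ⟩
    common L i * (1# - q ^ℕ suc i) + q ^ℕ suc i * (common L i * (1# - q ^ℕ (L ℕ.∸ i)))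
      ≈⟨ +-cong (qBinomial-≡-common L i) (*-congˡ (qBinomial-suc-≡-common L i)) ⟨
    qBinomial L i + q ^ℕ suc i * qBinomial L (suc i) ∎
  ... | inj₂ L<i = begin
    qBinomial (suc L) (suc i)                         ≈⟨ qBinomial-zero (suc L) (suc i) (ℕ.s≤s L<i) ⟩
    0#                                                ≈⟨ +-identityʳ _ ⟨
    0# + 0#                                           ≈⟨ +-cong (qBinomial-zero L i L<i) (y≈0⇒x*y≈0 _ (qBinomial-zero L (suc i) (ℕ.m<n⇒m<1+n L<i))) ⟨
    qBinomial L i + q ^ℕ suc i * qBinomial L (suc i)  ∎

  qBinomial-pascal′ : ∀ L i → qBinomial (suc L) (suc i) ≈ q ^ℕ (L ℕ.∸ i) * qBinomial L i + qBinomial L (suc i)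
  qBinomial-pascal′ L i with ℕ.≤-<-connex i L
  ... | inj₁ i≤L = begin
    qBinomial (suc L) (suc i)
      ≈⟨ qBinomial-suc-suc L i ⟩
    (1# - q ^ℕ suc L) * common L i
      ≈⟨ *-congʳ (+-congˡ (-‿cong (^ℕ-split q (ℕ.s≤s i≤L)))) ⟩
    (1# - q ^ℕ suc i * q ^ℕ (L ℕ.∸ i)) * common L i
      ≈⟨ solve 3 (λ a b c → (con (+ 1) :- a :* b) :* c := b :* (c :* (con (+ 1) :- a)) :+ c :* (con (+ 1) :- b)) refl _ _ _ ⟩
    q ^ℕ (L ℕ.∸ i) * (common L i * (1# - q ^ℕ suc i)) + common L i * (1# - q ^ℕ (L ℕ.∸ i))
      ≈⟨ +-cong (*-congˡ (qBinomial-≡-common L i)) (qBinomial-suc-≡-common L i) ⟨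
    q ^ℕ (L ℕ.∸ i) * qBinomial L i + qBinomial L (suc i) ∎
  ... | inj₂ L<i = begin
    qBinomial (suc L) (suc i)                           ≈⟨ qBinomial-zero (suc L) (suc i) (ℕ.s≤s L<i) ⟩
    0#                                                  ≈⟨ +-identityʳ _ ⟨
    0# + 0#                                             ≈⟨ +-cong (y≈0⇒x*y≈0 _ (qBinomial-zero L i L<i)) (qBinomial-zero L (suc i) (ℕ.m<n⇒m<1+n L<i)) ⟨
    q ^ℕ (L ℕ.∸ i) * qBinomial L i + qBinomial L (suc i) ∎

  binomialSum : ℕ → (ℕ → Carrier) → Carrier
  binomialSum L g = ∑< (suc L) (λ i → qBinomial L i * g i)

  binomialSum-cong : ∀ L {f g} → (∀ i → i ℕ.≤ L → f i ≈ g i) → binomialSum L f ≈ binomialSum L g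
  binomialSum-cong L f≈g = ∑-cong (suc L) (λ i i≤L → *-congˡ {qBinomial L i} (f≈g i (ℕ.≤-pred i≤L)))

  binomialSum-*ˡ : ∀ L a g → binomialSum L (λ i → a * g i) ≈ a * binomialSum L g
  binomialSum-*ˡ L a g = begin
    ∑< (suc L) (λ i → qBinomial L i * (a * g i))   ≈⟨ ∑-cong (suc L) (λ i _ → x[yz]≈y[xz] (qBinomial L i) a (g i)) ⟩
    ∑< (suc L) (λ i → a * (qBinomial L i * g i))   ≈⟨ *-distribˡ-∑ a (λ i → qBinomial L i * g i) (suc L) ⟨
    a * binomialSum L g                        ∎
    where
    x[yz]≈y[xz] : ∀ x y z → x * (y * z) ≈ y * (x * z)
    x[yz]≈y[xz] = solve 3 (λ x y z → x :* (y :* z) := y :* (x :* z)) refl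

  binomialSum-recurrence : ∀ L g (α β : ℕ → Carrier) → β 0 ≈ 1# →
    (∀ i → qBinomial (suc L) (suc i) ≈ α i * qBinomial L i + β (suc i) * qBinomial L (suc i)) →
    binomialSum (suc L) g ≈ binomialSum L (λ i → β i * g i + α i * g (suc i))
  binomialSum-recurrence L g α β β0≈1 pascal = begin
    qBinomial (suc L) 0 * g 0 + ∑< (suc L) (λ i → qBinomial (suc L) (suc i) * g (suc i))
      ≈⟨ +-cong (*-congʳ (qBinomial-0 (suc L)) ⟨ trans ⟩ *-identityˡ _)
                (∑-cong (suc L) (λ i _ → *-congʳ (pascal i) ⟨ trans ⟩ distribʳ (g (suc i)) _ _)) ⟩
    g 0 + ∑< (suc L) (λ i → left i + right i)
      ≈⟨ +-congˡ (∑-distrib-+ left right (suc L)) ⟩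
    g 0 + (∑< (suc L) left + ∑< (suc L) right)
      ≈⟨ +-congˡ (+-congˡ (∑-dropFinalZeros right L (suc L) (ℕ.n≤1+n L) right-vanishes)) ⟩
    g 0 + (∑< (suc L) left + ∑< L right)
      ≈⟨ solve 3 (λ a b c → a :+ (b :+ c) := (a :+ c) :+ b) refl _ _ _ ⟩
    (g 0 + ∑< L right) + ∑< (suc L) left
      ≈⟨ +-cong (+-cong (sym head) (∑-cong L (λ i _ → swap (β (suc i)) (qBinomial L (suc i)) (g (suc i))))) (∑-cong (suc L) (λ i _ → swap (α i) (qBinomial L i) (g (suc i)))) ⟩
    ∑< (suc L) (λ i → qBinomial L i * (β i * g i)) + ∑< (suc L) (λ i → qBinomial L i * (α i * g (suc i)))
      ≈⟨ ∑-distrib-+ (λ i → qBinomial L i * (β i * g i)) (λ i → qBinomial L i * (α i * g (suc i))) (suc L) ⟨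
    ∑< (suc L) (λ i → qBinomial L i * (β i * g i) + qBinomial L i * (α i * g (suc i)))
      ≈⟨ ∑-cong (suc L) (λ i _ → distribˡ (qBinomial L i) (β i * g i) (α i * g (suc i))) ⟨
    binomialSum L (λ i → β i * g i + α i * g (suc i)) ∎
    where
    left right : ℕ → Carrier
    left i  = α i * qBinomial L i * g (suc i)
    right i = β (suc i) * qBinomial L (suc i) * g (suc i)
    right-vanishes : ∀ i → L ℕ.≤ i → i ℕ.< suc L → right i ≈ 0#
    right-vanishes i L≤i _ = x≈0⇒x*y≈0 _ (y≈0⇒x*y≈0 _ (qBinomial-zero L (suc i) (ℕ.s≤s L≤i)))
    head : qBinomial L 0 * (β 0 * g 0) ≈ g 0
    head = *-congʳ (qBinomial-0 L) ⟨ trans ⟩ *-identityˡ _ ⟨ trans ⟩ *-congʳ β0≈1 ⟨ trans ⟩ *-identityˡ _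
    swap : ∀ a b c → a * b * c ≈ b * (a * c)
    swap = solve 3 (λ a b c → a :* b :* c := b :* (a :* c)) refl

  binomialSum-suc : ∀ L g → binomialSum (suc L) g ≈ binomialSum L (λ i → q ^ℕ i * g i + g (suc i))
  binomialSum-suc L g =
    binomialSum-recurrence L g (λ _ → 1#) (q ^ℕ_) refl
      (λ i → qBinomial-pascal L i ⟨ trans ⟩ +-congʳ (sym (*-identityˡ _)))
    ⟨ trans ⟩ binomialSum-cong L {λ i → q ^ℕ i * g i + 1# * g (suc i)} (λ i _ → +-congˡ (*-identityˡ (g (suc i))))

  binomialSum-suc′ : ∀ L g → binomialSum (suc L) g ≈ binomialSum L (λ i → g i + q ^ℕ (L ℕ.∸ i) * g (suc i))
  binomialSum-suc′ L g =
    binomialSum-recurrence L g (λ i → q ^ℕ (L ℕ.∸ i)) (λ _ → 1#) refl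
      (λ i → qBinomial-pascal′ L i ⟨ trans ⟩ +-congˡ (sym (*-identityˡ _)))
    ⟨ trans ⟩ binomialSum-cong L {λ i → 1# * g i + q ^ℕ (L ℕ.∸ i) * g (suc i)} (λ i _ → +-congʳ (*-identityˡ (g i)))

  private
    1+n∸k : ∀ {k n} → k ℕ.≤ n → suc n ℕ.∸ k ≡ suc (n ℕ.∸ k)
    1+n∸k k≤n = ℕ.+-∸-assoc 1 k≤n

    square-suc : ∀ i → suc i ℕ.* suc i ≡ i ℕ.* i ℕ.+ (i ℕ.+ (i ℕ.+ 1))
    square-suc = solve-∀

    q^[1+i]² : ∀ i → q ^ℕ (suc i ℕ.* suc i) ≈ q ^ℕ (i ℕ.* i) * (q ^ℕ i * (q ^ℕ i * q))
    q^[1+i]² i = begin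
      q ^ℕ (suc i ℕ.* suc i)                       ≡⟨ P.cong (q ^ℕ_) (square-suc i) ⟩
      q ^ℕ (i ℕ.* i ℕ.+ (i ℕ.+ (i ℕ.+ 1)))         ≈⟨ ^ℕ-homo-+ q (i ℕ.* i) _ ⟩
      q ^ℕ (i ℕ.* i) * q ^ℕ (i ℕ.+ (i ℕ.+ 1))      ≈⟨ *-congˡ (^ℕ-homo-+ q i _ ⟨ trans ⟩ *-congˡ (^ℕ-homo-+ q i 1)) ⟩
      q ^ℕ (i ℕ.* i) * (q ^ℕ i * (q ^ℕ i * (q * 1#))) ≈⟨ *-congˡ (*-congˡ (*-congˡ (*-identityʳ q))) ⟩
      q ^ℕ (i ℕ.* i) * (q ^ℕ i * (q ^ℕ i * q))     ∎

    pochℕ-peel : ∀ X i L → i ℕ.≤ L → pochℕ (X * q ^ℕ suc i) (suc L ℕ.∸ i)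
                 ≈ (1# - X * (q * q ^ℕ i)) * pochℕ (X * q ^ℕ suc (suc i)) (L ℕ.∸ i)
    pochℕ-peel X i L i≤L = begin
      pochℕ (X * q ^ℕ suc i) (suc L ℕ.∸ i)                          ≡⟨ P.cong (pochℕ (X * q ^ℕ suc i)) (1+n∸k i≤L) ⟩
      pochℕ (X * q ^ℕ suc i) (suc (L ℕ.∸ i))                        ≈⟨ pochℕ-suc (X * q ^ℕ suc i) (L ℕ.∸ i) ⟩
      (1# - X * (q * q ^ℕ i)) * pochℕ (X * q ^ℕ suc i * q) (L ℕ.∸ i) ≈⟨ *-congˡ (pochℕ-cong (L ℕ.∸ i) (shift X (q ^ℕ i))) ⟩
      (1# - X * (q * q ^ℕ i)) * pochℕ (X * q ^ℕ suc (suc i)) (L ℕ.∸ i) ∎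
      where
      shift : ∀ x a → x * (q * a) * q ≈ x * (q * (q * a))
      shift x a = solve 3 (λ x a y → x :* (y :* a) :* y := x :* (y :* (y :* a))) refl x a q

  unitySummand : ℕ → Carrier → ℕ → Carrier
  unitySummand L X i = X ^ℕ i * q ^ℕ (i ℕ.* i) * pochℕ (X * q ^ℕ suc i) (L ℕ.∸ i)

  unitySummand-step : ∀ L X i → i ℕ.≤ L →
    q ^ℕ i * unitySummand (suc L) X i + unitySummand (suc L) X (suc i) ≈ unitySummand L (X * q) i
  unitySummand-step L X i i≤L = begin
    q ^ℕ i * (X ^ℕ i * q ^ℕ (i ℕ.* i) * pochℕ (X * q ^ℕ suc i) (suc L ℕ.∸ i)) + X ^ℕ suc i * q ^ℕ (suc i ℕ.* suc i) * R
      ≈⟨ +-cong (*-congˡ (*-congˡ (pochℕ-peel X i L i≤L))) (*-congʳ (*-congˡ (q^[1+i]² i))) ⟩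
    q ^ℕ i * (X ^ℕ i * q ^ℕ (i ℕ.* i) * ((1# - X * (q * q ^ℕ i)) * R)) + X * X ^ℕ i * (q ^ℕ (i ℕ.* i) * (q ^ℕ i * (q ^ℕ i * q))) * R
      ≈⟨ solve 6 (λ x y xi qi qii r → qi :* (xi :* qii :* ((con (+ 1) :- x :* (y :* qi)) :* r)) :+ x :* xi :* (qii :* (qi :* (qi :* y))) :* r
                                      := xi :* qi :* qii :* r) refl X q (X ^ℕ i) (q ^ℕ i) (q ^ℕ (i ℕ.* i)) R ⟩
    X ^ℕ i * q ^ℕ i * q ^ℕ (i ℕ.* i) * R
      ≈⟨ *-cong (*-congʳ (^ℕ-distrib-* X q i)) (pochℕ-cong (L ℕ.∸ i) (*-assoc X q (q ^ℕ suc i))) ⟨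
    unitySummand L (X * q) i ∎
    where
    R = pochℕ (X * q ^ℕ suc (suc i)) (L ℕ.∸ i)

  q-partitionOfUnity : ∀ L X → binomialSum L (unitySummand L X) ≈ 1#
  q-partitionOfUnity zero    X = begin
    qBinomial 0 0 * (1# * 1# * 1#) + 0# ≈⟨ +-identityʳ _ ⟩
    qBinomial 0 0 * (1# * 1# * 1#)      ≈⟨ *-cong (qBinomial-0 0) (*-identityʳ _ ⟨ trans ⟩ *-identityʳ _) ⟩
    1# * 1#                             ≈⟨ *-identityʳ _ ⟩
    1#                                  ∎
  q-partitionOfUnity (suc L) X = begin
    binomialSum (suc L) (unitySummand (suc L) X)
      ≈⟨ binomialSum-suc L (unitySummand (suc L) X) ⟩
    binomialSum L (λ i → q ^ℕ i * unitySummand (suc L) X i + unitySummand (suc L) X (suc i))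
      ≈⟨ binomialSum-cong L (unitySummand-step L X) ⟩
    binomialSum L (unitySummand L (X * q))
      ≈⟨ q-partitionOfUnity L (X * q) ⟩
    1# ∎

  shiftedPochSummand : ℕ → ℕ → Carrier → ℕ → Carrier
  shiftedPochSummand N M X k = qFalling M k * X ^ℕ k * q ^ℕ (k ℕ.* k) * pochℕ (X * q ^ℕ suc k) (N ℕ.∸ k)

  shiftedPochSummand-step : ∀ N M X k → k ℕ.≤ N →
    q ^ℕ k * shiftedPochSummand (suc N) M X k + shiftedPochSummand (suc N) M X (suc k)
    ≈ (1# - X * q ^ℕ suc M) * shiftedPochSummand N M (X * q) k
  shiftedPochSummand-step N M X k k≤N = begin
    q ^ℕ k * (qFalling M k * X ^ℕ k * q ^ℕ (k ℕ.* k) * pochℕ (X * q ^ℕ suc k) (suc N ℕ.∸ k))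
      + qFalling M k * (1# - q ^ℕ (M ℕ.∸ k)) * (X * X ^ℕ k) * q ^ℕ (suc k ℕ.* suc k) * R
      ≈⟨ +-cong (*-congˡ (*-congˡ (pochℕ-peel X k N k≤N))) (*-congʳ (*-congˡ (q^[1+i]² k))) ⟩
    q ^ℕ k * (d * X ^ℕ k * q ^ℕ (k ℕ.* k) * ((1# - X * (q * q ^ℕ k)) * R))
      + d * (1# - q ^ℕ (M ℕ.∸ k)) * (X * X ^ℕ k) * (q ^ℕ (k ℕ.* k) * (q ^ℕ k * (q ^ℕ k * q))) * R
      ≈⟨ collect ⟩
    (1# - X * q ^ℕ suc M) * (d * (X ^ℕ k * q ^ℕ k) * q ^ℕ (k ℕ.* k) * R)
      ≈⟨ *-congˡ (*-cong (*-congʳ (*-congˡ (^ℕ-distrib-* X q k))) (pochℕ-cong (N ℕ.∸ k) (*-assoc X q (q ^ℕ suc k)))) ⟨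
    (1# - X * q ^ℕ suc M) * shiftedPochSummand N M (X * q) k ∎
    where
    d = qFalling M k
    R = pochℕ (X * q ^ℕ suc (suc k)) (N ℕ.∸ k)
    collect : q ^ℕ k * (d * X ^ℕ k * q ^ℕ (k ℕ.* k) * ((1# - X * (q * q ^ℕ k)) * R))
                + d * (1# - q ^ℕ (M ℕ.∸ k)) * (X * X ^ℕ k) * (q ^ℕ (k ℕ.* k) * (q ^ℕ k * (q ^ℕ k * q))) * R
              ≈ (1# - X * q ^ℕ suc M) * (d * (X ^ℕ k * q ^ℕ k) * q ^ℕ (k ℕ.* k) * R)
    collect with ℕ.≤-<-connex k M
    ... | inj₁ k≤M =
      solve 8 (λ x y d xk qk qkk r t →
          qk :* (d :* xk :* qkk :* ((con (+ 1) :- x :* (y :* qk)) :* r)) :+ d :* (con (+ 1) :- t) :* (x :* xk) :* (qkk :* (qk :* (qk :* y))) :* r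
          := (con (+ 1) :- x :* ((y :* qk) :* t)) :* (d :* (xk :* qk) :* qkk :* r))
        refl X q d (X ^ℕ k) (q ^ℕ k) (q ^ℕ (k ℕ.* k)) R (q ^ℕ (M ℕ.∸ k))
      ⟨ trans ⟩ *-congʳ (+-congˡ (-‿cong (*-congˡ (sym (^ℕ-split q (ℕ.s≤s k≤M))))))
    ... | inj₂ M<k =
      +-cong (y≈0⇒x*y≈0 _ (d*a*b*c≈0 _ _ _)) (x≈0⇒x*y≈0 R (d*a*b*c≈0 _ _ _))
      ⟨ trans ⟩ +-identityʳ _ ⟨ trans ⟩ sym (y≈0⇒x*y≈0 _ (d*a*b*c≈0 _ _ _))
      where
      d*a*b*c≈0 : ∀ a b c → d * a * b * c ≈ 0#
      d*a*b*c≈0 a b c = x≈0⇒x*y≈0 c (x≈0⇒x*y≈0 b (x≈0⇒x*y≈0 a (qFalling-zero M k M<k)))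

  shiftedPochExpansion : ∀ N M X → binomialSum N (shiftedPochSummand N M X) ≈ pochℕ (X * q ^ℕ suc M) N
  shiftedPochExpansion zero    M X = begin
    qBinomial 0 0 * (1# * 1# * 1# * 1#) + 0# ≈⟨ +-identityʳ _ ⟩
    qBinomial 0 0 * (1# * 1# * 1# * 1#)      ≈⟨ *-cong (qBinomial-0 0) (*-identityʳ _ ⟨ trans ⟩ *-identityʳ _ ⟨ trans ⟩ *-identityʳ _) ⟩
    1# * 1#                                  ≈⟨ *-identityʳ _ ⟩
    1#                                       ∎
  shiftedPochExpansion (suc N) M X = begin
    binomialSum (suc N) (shiftedPochSummand (suc N) M X)
      ≈⟨ binomialSum-suc N (shiftedPochSummand (suc N) M X) ⟩
    binomialSum N (λ k → q ^ℕ k * shiftedPochSummand (suc N) M X k + shiftedPochSummand (suc N) M X (suc k))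
      ≈⟨ binomialSum-cong N (shiftedPochSummand-step N M X) ⟩
    binomialSum N (λ k → (1# - X * q ^ℕ suc M) * shiftedPochSummand N M (X * q) k)
      ≈⟨ binomialSum-*ˡ N _ (shiftedPochSummand N M (X * q)) ⟩
    (1# - X * q ^ℕ suc M) * binomialSum N (shiftedPochSummand N M (X * q))
      ≈⟨ *-congˡ (shiftedPochExpansion N M (X * q)) ⟩
    (1# - X * q ^ℕ suc M) * pochℕ (X * q * q ^ℕ suc M) N
      ≈⟨ *-congˡ (pochℕ-cong N (solve 3 (λ x a b → x :* a :* b := x :* b :* a) refl X q _)) ⟩
    (1# - X * q ^ℕ suc M) * pochℕ (X * q ^ℕ suc M * q) N
      ≈⟨ pochℕ-suc (X * q ^ℕ suc M) N ⟨
    pochℕ (X * q ^ℕ suc M) (suc N) ∎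

  private
    vandermonde-collect : ∀ b k s x R →
      qFalling b k * q ^ℕ (b ℕ.∸ k ℕ.+ s ℕ.* (b ℕ.∸ k)) * ((1# - x * q ^ℕ k) * R)
        + q ^ℕ s * (qFalling b k * (1# - q ^ℕ (b ℕ.∸ k)) * q ^ℕ (s ℕ.* (b ℕ.∸ suc k)) * R)
      ≈ (1# - x * q ^ℕ b) * (qFalling b k * q ^ℕ (s ℕ.* (b ℕ.∸ k)) * R)
    vandermonde-collect b k s x R with ℕ.<-cmp k b
    ... | tri< k<b _ _ = begin
      d * q ^ℕ (b ℕ.∸ k ℕ.+ s ℕ.* (b ℕ.∸ k)) * ((1# - x * q ^ℕ k) * R)
        + q ^ℕ s * (d * (1# - q ^ℕ (b ℕ.∸ k)) * q ^ℕ (s ℕ.* t) * R)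
        ≈⟨ +-cong (*-congʳ (*-congˡ (^ℕ-congʳ q (P.cong (λ m → m ℕ.+ s ℕ.* m) b∸k≡1+t) ⟨ trans ⟩ q^[1+t+s[1+t]])))
                  (*-congˡ (*-congʳ (*-congʳ (*-congˡ (+-congˡ (-‿cong (^ℕ-congʳ q b∸k≡1+t))))))) ⟩
      d * (q ^ℕ suc t * (q ^ℕ s * q ^ℕ (s ℕ.* t))) * ((1# - x * q ^ℕ k) * R)
        + q ^ℕ s * (d * (1# - q ^ℕ suc t) * q ^ℕ (s ℕ.* t) * R)
        ≈⟨ solve 7 (λ x d r qk qt qs e →
             d :* (qt :* (qs :* e)) :* ((con (+ 1) :- x :* qk) :* r) :+ qs :* (d :* (con (+ 1) :- qt) :* e :* r)
             := (con (+ 1) :- x :* (qk :* qt)) :* (d :* (qs :* e) :* r))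
           refl x d R (q ^ℕ k) (q ^ℕ suc t) (q ^ℕ s) (q ^ℕ (s ℕ.* t)) ⟩
      (1# - x * (q ^ℕ k * q ^ℕ suc t)) * (d * (q ^ℕ s * q ^ℕ (s ℕ.* t)) * R)
        ≈⟨ *-cong (+-congˡ (-‿cong (*-congˡ (^ℕ-split q (ℕ.<⇒≤ k<b) ⟨ trans ⟩ *-congˡ (^ℕ-congʳ q b∸k≡1+t)))))
                  (*-congʳ (*-congˡ (^ℕ-congʳ q (P.cong (s ℕ.*_) b∸k≡1+t) ⟨ trans ⟩ q^s[1+t]))) ⟨
      (1# - x * q ^ℕ b) * (d * q ^ℕ (s ℕ.* (b ℕ.∸ k)) * R) ∎
      where
      d = qFalling b k
      t = b ℕ.∸ suc k
      b∸k≡1+t : b ℕ.∸ k ≡ suc t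
      b∸k≡1+t = ℕ.+-∸-assoc 1 k<b
      q^s[1+t] : q ^ℕ (s ℕ.* suc t) ≈ q ^ℕ s * q ^ℕ (s ℕ.* t)
      q^s[1+t] = ^ℕ-congʳ q (ℕ.*-suc s t) ⟨ trans ⟩ ^ℕ-homo-+ q s (s ℕ.* t)
      q^[1+t+s[1+t]] : q ^ℕ (suc t ℕ.+ s ℕ.* suc t) ≈ q ^ℕ suc t * (q ^ℕ s * q ^ℕ (s ℕ.* t))
      q^[1+t+s[1+t]] = ^ℕ-homo-+ q (suc t) (s ℕ.* suc t) ⟨ trans ⟩ *-congˡ q^s[1+t]
    ... | tri≈ _ P.refl _ = begin
      d * q ^ℕ (k ℕ.∸ k ℕ.+ s ℕ.* (k ℕ.∸ k)) * ((1# - x * q ^ℕ k) * R)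
        + q ^ℕ s * (d * (1# - q ^ℕ (k ℕ.∸ k)) * q ^ℕ (s ℕ.* (k ℕ.∸ suc k)) * R)
        ≈⟨ +-cong (*-congʳ (*-congˡ (^ℕ-congʳ q exponent≡0)))
                  (y≈0⇒x*y≈0 _ (x≈0⇒x*y≈0 _ (x≈0⇒x*y≈0 _ (y≈0⇒x*y≈0 _ 1-q^[k∸k]≈0)))) ⟩
      d * 1# * ((1# - x * q ^ℕ k) * R) + 0#
        ≈⟨ solve 4 (λ d x qk r → d :* con (+ 1) :* ((con (+ 1) :- x :* qk) :* r) :+ con (+ 0)
                                 := (con (+ 1) :- x :* qk) :* (d :* con (+ 1) :* r)) refl d x (q ^ℕ k) R ⟩
      (1# - x * q ^ℕ k) * (d * 1# * R)
        ≈⟨ *-congˡ (*-congʳ (*-congˡ (^ℕ-congʳ q s*[k∸k]≡0))) ⟨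
      (1# - x * q ^ℕ k) * (d * q ^ℕ (s ℕ.* (k ℕ.∸ k)) * R) ∎
      where
      d = qFalling k k
      s*[k∸k]≡0 : s ℕ.* (k ℕ.∸ k) ≡ 0
      s*[k∸k]≡0 = P.cong (s ℕ.*_) (ℕ.n∸n≡0 k) ⟨ P.trans ⟩ ℕ.*-zeroʳ s
      exponent≡0 : k ℕ.∸ k ℕ.+ s ℕ.* (k ℕ.∸ k) ≡ 0
      exponent≡0 = P.cong₂ ℕ._+_ (ℕ.n∸n≡0 k) s*[k∸k]≡0
      1-q^[k∸k]≈0 : 1# - q ^ℕ (k ℕ.∸ k) ≈ 0#
      1-q^[k∸k]≈0 = +-congˡ (-‿cong (^ℕ-congʳ q (ℕ.n∸n≡0 k))) ⟨ trans ⟩ -‿inverseʳ 1#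
    ... | tri> _ _ b<k =
      +-cong (x≈0⇒x*y≈0 _ (x≈0⇒x*y≈0 _ d≈0)) (y≈0⇒x*y≈0 _ (x≈0⇒x*y≈0 _ (x≈0⇒x*y≈0 _ (x≈0⇒x*y≈0 _ d≈0))))
      ⟨ trans ⟩ +-identityʳ _ ⟨ trans ⟩ sym (y≈0⇒x*y≈0 _ (x≈0⇒x*y≈0 _ (x≈0⇒x*y≈0 _ d≈0)))
      where
      d≈0 : qFalling b k ≈ 0#
      d≈0 = qFalling-zero b k b<k

  vandermondeSummand : ℕ → ℕ → Carrier → ℕ → Carrier
  vandermondeSummand a b x k = qFalling b k * q ^ℕ ((a ℕ.∸ k) ℕ.* (b ℕ.∸ k)) * pochℕ (x * q ^ℕ k) (a ℕ.∸ k)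

  vandermondeSummand-step : ∀ a b x k → k ℕ.≤ a →
    vandermondeSummand (suc a) b x k + q ^ℕ (a ℕ.∸ k) * vandermondeSummand (suc a) b x (suc k)
    ≈ (1# - x * q ^ℕ b) * vandermondeSummand a b (x * q) k
  vandermondeSummand-step a b x k k≤a = begin
    d * q ^ℕ ((suc a ℕ.∸ k) ℕ.* (b ℕ.∸ k)) * pochℕ (x * q ^ℕ k) (suc a ℕ.∸ k)
      + q ^ℕ s * (d * (1# - q ^ℕ (b ℕ.∸ k)) * q ^ℕ (s ℕ.* (b ℕ.∸ suc k)) * R)
      ≈⟨ +-congʳ (*-cong (*-congˡ (^ℕ-congʳ q (P.cong (ℕ._* (b ℕ.∸ k)) (1+n∸k k≤a)))) peel) ⟩
    d * q ^ℕ (b ℕ.∸ k ℕ.+ s ℕ.* (b ℕ.∸ k)) * ((1# - x * q ^ℕ k) * R)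
      + q ^ℕ s * (d * (1# - q ^ℕ (b ℕ.∸ k)) * q ^ℕ (s ℕ.* (b ℕ.∸ suc k)) * R)
      ≈⟨ vandermonde-collect b k s x R ⟩
    (1# - x * q ^ℕ b) * (d * q ^ℕ (s ℕ.* (b ℕ.∸ k)) * R)
      ≈⟨ *-congˡ (*-congˡ (pochℕ-cong s (*-assoc x q (q ^ℕ k)))) ⟨
    (1# - x * q ^ℕ b) * vandermondeSummand a b (x * q) k ∎
    where
    d = qFalling b k
    s = a ℕ.∸ k
    R = pochℕ (x * q ^ℕ suc k) s
    peel : pochℕ (x * q ^ℕ k) (suc a ℕ.∸ k) ≈ (1# - x * q ^ℕ k) * R
    peel = reflexive (P.cong (pochℕ (x * q ^ℕ k)) (1+n∸k k≤a))
           ⟨ trans ⟩ pochℕ-suc (x * q ^ℕ k) s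
           ⟨ trans ⟩ *-congˡ (pochℕ-cong s (solve 3 (λ x a b → x :* b :* a := x :* (a :* b)) refl x q (q ^ℕ k)))
  q-vandermonde : ∀ a b x → binomialSum a (vandermondeSummand a b x) ≈ pochℕ (x * q ^ℕ b) a
  q-vandermonde zero    b x = begin
    qBinomial 0 0 * (qFalling b 0 * q ^ℕ 0 * 1#) + 0#  ≈⟨ +-identityʳ _ ⟩
    qBinomial 0 0 * (1# * 1# * 1#)                     ≈⟨ *-cong (qBinomial-0 0) (*-identityʳ _ ⟨ trans ⟩ *-identityʳ _) ⟩
    1# * 1#                                            ≈⟨ *-identityʳ _ ⟩
    1#                                                 ∎
  q-vandermonde (suc a) b x = begin
    binomialSum (suc a) (vandermondeSummand (suc a) b x)
      ≈⟨ binomialSum-suc′ a (vandermondeSummand (suc a) b x) ⟩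
    binomialSum a (λ k → vandermondeSummand (suc a) b x k + q ^ℕ (a ℕ.∸ k) * vandermondeSummand (suc a) b x (suc k))
      ≈⟨ binomialSum-cong a (vandermondeSummand-step a b x) ⟩
    binomialSum a (λ k → (1# - x * q ^ℕ b) * vandermondeSummand a b (x * q) k)
      ≈⟨ binomialSum-*ˡ a _ (vandermondeSummand a b (x * q)) ⟩
    (1# - x * q ^ℕ b) * binomialSum a (vandermondeSummand a b (x * q))
      ≈⟨ *-congˡ (q-vandermonde a b (x * q)) ⟩
    (1# - x * q ^ℕ b) * pochℕ (x * q * q ^ℕ b) a
      ≈⟨ *-congˡ (pochℕ-cong a (solve 3 (λ x a b → x :* a :* b := x :* b :* a) refl x q _)) ⟩
    (1# - x * q ^ℕ b) * pochℕ (x * q ^ℕ b * q) a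
      ≈⟨ pochℕ-suc (x * q ^ℕ b) a ⟨
    pochℕ (x * q ^ℕ b) (suc a) ∎

  qFactorial⁻¹*qFalling : ∀ k i → qFactorial⁻¹ (k ℕ.+ i) * qFalling (k ℕ.+ i) k ≈ qFactorial⁻¹ i
  qFactorial⁻¹*qFalling k i = begin
    qFactorial⁻¹ (k ℕ.+ i) * qFalling (k ℕ.+ i) k
      ≈⟨ *-identityʳ _ ⟨
    qFactorial⁻¹ (k ℕ.+ i) * qFalling (k ℕ.+ i) k * 1#
      ≈⟨ *-congˡ (qFactorial⁻¹-inverse i) ⟨
    qFactorial⁻¹ (k ℕ.+ i) * qFalling (k ℕ.+ i) k * (pochℕ q i * qFactorial⁻¹ i)
      ≈⟨ solve 4 (λ a b c d → a :* b :* (c :* d) := a :* (b :* c) :* d) refl _ _ _ _ ⟩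
    qFactorial⁻¹ (k ℕ.+ i) * (qFalling (k ℕ.+ i) k * pochℕ q i) * qFactorial⁻¹ i
      ≈⟨ *-congʳ (*-congˡ (*-congˡ (reflexive (P.cong (pochℕ q) (P.sym (ℕ.m+n∸m≡n k i))))
                           ⟨ trans ⟩ qFalling*poch (k ℕ.+ i) k (ℕ.m≤m+n k i))) ⟩
    qFactorial⁻¹ (k ℕ.+ i) * pochℕ q (k ℕ.+ i) * qFactorial⁻¹ i
      ≈⟨ *-congʳ (*-comm _ _ ⟨ trans ⟩ qFactorial⁻¹-inverse (k ℕ.+ i)) ⟩
    1# * qFactorial⁻¹ i
      ≈⟨ *-identityˡ _ ⟩
    qFactorial⁻¹ i ∎

  qBinomial-*-qFalling : ∀ M k j → qBinomial M (k ℕ.+ j) * qFalling (k ℕ.+ j) k ≈ qFalling M k * qBinomial (M ℕ.∸ k) j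
  qBinomial-*-qFalling M k j = begin
    qFalling M (k ℕ.+ j) * qFactorial⁻¹ (k ℕ.+ j) * qFalling (k ℕ.+ j) k
      ≈⟨ *-congʳ (*-congʳ (qFalling-+ M k j)) ⟩
    qFalling M k * qFalling (M ℕ.∸ k) j * qFactorial⁻¹ (k ℕ.+ j) * qFalling (k ℕ.+ j) k
      ≈⟨ *-assoc _ _ _ ⟩
    qFalling M k * qFalling (M ℕ.∸ k) j * (qFactorial⁻¹ (k ℕ.+ j) * qFalling (k ℕ.+ j) k)
      ≈⟨ *-congˡ (qFactorial⁻¹*qFalling k j) ⟩
    qFalling M k * qFalling (M ℕ.∸ k) j * qFactorial⁻¹ j
      ≈⟨ *-assoc _ _ _ ⟩
    qFalling M k * qBinomial (M ℕ.∸ k) j ∎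

  qBinomial-*-qBinomial : ∀ N k i → qBinomial N (k ℕ.+ i) * qBinomial (k ℕ.+ i) k ≈ qBinomial N k * qBinomial (N ℕ.∸ k) i
  qBinomial-*-qBinomial N k i = begin
    qBinomial N (k ℕ.+ i) * (qFalling (k ℕ.+ i) k * qFactorial⁻¹ k)
      ≈⟨ sym (*-assoc _ _ _) ⟩
    qBinomial N (k ℕ.+ i) * qFalling (k ℕ.+ i) k * qFactorial⁻¹ k
      ≈⟨ *-congʳ (qBinomial-*-qFalling N k i) ⟩
    qFalling N k * qBinomial (N ℕ.∸ k) i * qFactorial⁻¹ k
      ≈⟨ solve 3 (λ a b c → a :* b :* c := a :* c :* b) refl _ _ _ ⟩
    qBinomial N k * qBinomial (N ℕ.∸ k) i ∎

  qFactorial⁻¹-∸ : ∀ L a → a ℕ.≤ L → qFactorial⁻¹ (L ℕ.∸ a) ≈ qFactorial⁻¹ L * qFalling L a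
  qFactorial⁻¹-∸ L a a≤L = begin
    qFactorial⁻¹ (L ℕ.∸ a)
      ≈⟨ (*-congʳ (*-comm _ _ ⟨ trans ⟩ qFactorial⁻¹-inverse L) ⟨ trans ⟩ *-identityˡ _) ⟨
    (qFactorial⁻¹ L * pochℕ q L) * qFactorial⁻¹ (L ℕ.∸ a)
      ≈⟨ *-congʳ (*-congˡ (qFalling*poch L a a≤L)) ⟨
    (qFactorial⁻¹ L * (qFalling L a * pochℕ q (L ℕ.∸ a))) * qFactorial⁻¹ (L ℕ.∸ a)
      ≈⟨ solve 4 (λ i d p j → i :* (d :* p) :* j := i :* d :* (p :* j)) refl _ _ _ _ ⟩
    qFactorial⁻¹ L * qFalling L a * (pochℕ q (L ℕ.∸ a) * qFactorial⁻¹ (L ℕ.∸ a))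
      ≈⟨ (*-congˡ (qFactorial⁻¹-inverse (L ℕ.∸ a)) ⟨ trans ⟩ *-identityʳ _) ⟩
    qFactorial⁻¹ L * qFalling L a ∎

quadraticForm : ℤ → ℤ → ℤ
quadraticForm A B = A ℤ.* A ℤ.- A ℤ.* B ℤ.+ B ℤ.* B

quadraticForm-shift : ∀ K I J → (K ℤ.+ I) ℤ.* (K ℤ.+ I) ℤ.- (K ℤ.+ I) ℤ.* (K ℤ.+ J) ℤ.+ (K ℤ.+ J) ℤ.* (K ℤ.+ J) ℤ.+ I ℤ.* J
                                ≡ K ℤ.* K ℤ.+ (K ℤ.* I ℤ.+ I ℤ.* I) ℤ.+ (K ℤ.* J ℤ.+ J ℤ.* J)
quadraticForm-shift = ZS.solve-∀

module DoubleSum {c ℓ : Level} (F : Field c ℓ) (z w q : Field.Carrier F)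
  (1-q^[1+j]≉0 : ∀ j → FieldProperties.NonZero F (Field._-_ F (Field.1# F) (QSeries._^ℕ_ F z w q q (suc j))))
  (q≉0 : FieldProperties.NonZero F q)
  (Z W : Field.Carrier F) (N M : ℕ) where
  open Field F hiding (zero)
  open QSeries F z w q
  open FieldProperties F
  open Powers F z w q
  open Pochhammer F z w q
  open GaussianBinomial F z w q 1-q^[1+j]≉0

  x : Carrier
  x = Z * W * q

  monomial : ℕ → ℕ → Carrier
  monomial a b = Z ^ℕ a * W ^ℕ b * q ^ℤ quadraticForm (+ a) (+ b)

  monomial-shift : ∀ k i j → monomial (k ℕ.+ i) (k ℕ.+ j) * q ^ℕ (i ℕ.* j)
    ≈ (Z * W) ^ℕ k * q ^ℕ (k ℕ.* k) * ((Z * q ^ℕ k) ^ℕ i * q ^ℕ (i ℕ.* i)) * ((W * q ^ℕ k) ^ℕ j * q ^ℕ (j ℕ.* j))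
  monomial-shift k i j = begin
    Z ^ℕ (k ℕ.+ i) * W ^ℕ (k ℕ.+ j) * q ^ℤ quadraticForm (+ (k ℕ.+ i)) (+ (k ℕ.+ j)) * q ^ℕ (i ℕ.* j)
      ≈⟨ *-assoc _ _ _ ⟩
    Z ^ℕ (k ℕ.+ i) * W ^ℕ (k ℕ.+ j) * (q ^ℤ quadraticForm (+ (k ℕ.+ i)) (+ (k ℕ.+ j)) * q ^ℕ (i ℕ.* j))
      ≈⟨ *-cong (*-cong (^ℕ-homo-+ Z k i) (^ℕ-homo-+ W k j)) exponent ⟩
    Z ^ℕ k * Z ^ℕ i * (W ^ℕ k * W ^ℕ j) * (q ^ℕ (k ℕ.* k) * (q ^ℕ (k ℕ.* i) * q ^ℕ (i ℕ.* i)) * (q ^ℕ (k ℕ.* j) * q ^ℕ (j ℕ.* j)))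
      ≈⟨ solve 9 (λ zk zi wk wj a b c d e → zk :* zi :* (wk :* wj) :* (a :* (b :* c) :* (d :* e))
                                         := zk :* wk :* a :* (zi :* b :* c) :* (wj :* d :* e)) refl _ _ _ _ _ _ _ _ _ ⟩
    Z ^ℕ k * W ^ℕ k * q ^ℕ (k ℕ.* k) * (Z ^ℕ i * q ^ℕ (k ℕ.* i) * q ^ℕ (i ℕ.* i)) * (W ^ℕ j * q ^ℕ (k ℕ.* j) * q ^ℕ (j ℕ.* j))
      ≈⟨ *-cong (*-cong (*-congʳ (^ℕ-distrib-* Z W k)) (*-congʳ (^ℕ-distrib-* Z (q ^ℕ k) i ⟨ trans ⟩ *-congˡ (^ℕ-assocʳ q k i))))
                (*-congʳ (^ℕ-distrib-* W (q ^ℕ k) j ⟨ trans ⟩ *-congˡ (^ℕ-assocʳ q k j))) ⟨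
    (Z * W) ^ℕ k * q ^ℕ (k ℕ.* k) * ((Z * q ^ℕ k) ^ℕ i * q ^ℕ (i ℕ.* i)) * ((W * q ^ℕ k) ^ℕ j * q ^ℕ (j ℕ.* j)) ∎
    where
    q^[+a*+b] : ∀ a b → q ^ℤ (+ a ℤ.* + b) ≈ q ^ℕ (a ℕ.* b)
    q^[+a*+b] a b = ^ℤ-congʳ q (P.sym (ℤ.pos-* a b))
    exponent : q ^ℤ quadraticForm (+ (k ℕ.+ i)) (+ (k ℕ.+ j)) * q ^ℕ (i ℕ.* j)
               ≈ q ^ℕ (k ℕ.* k) * (q ^ℕ (k ℕ.* i) * q ^ℕ (i ℕ.* i)) * (q ^ℕ (k ℕ.* j) * q ^ℕ (j ℕ.* j))
    exponent = begin
      q ^ℤ Q * q ^ℕ (i ℕ.* j)                ≈⟨ *-congˡ (q^[+a*+b] i j) ⟨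
      q ^ℤ Q * q ^ℤ (+ i ℤ.* + j)            ≈⟨ ^ℤ-homo-+ q≉0 Q (+ i ℤ.* + j) ⟨
      q ^ℤ (Q ℤ.+ + i ℤ.* + j)               ≡⟨ P.cong (q ^ℤ_) Q+ij≡A+B+C ⟩
      q ^ℤ (A ℤ.+ B ℤ.+ C)                   ≈⟨ (^ℤ-homo-+ q≉0 (A ℤ.+ B) C ⟨ trans ⟩ *-congʳ (^ℤ-homo-+ q≉0 A B)) ⟩
      q ^ℤ A * q ^ℤ B * q ^ℤ C               ≈⟨ *-cong (*-cong (q^[+a*+b] k k) (^ℤ-homo-+ q≉0 (+ k ℤ.* + i) (+ i ℤ.* + i) ⟨ trans ⟩ *-cong (q^[+a*+b] k i) (q^[+a*+b] i i)))
                                                          (^ℤ-homo-+ q≉0 (+ k ℤ.* + j) (+ j ℤ.* + j) ⟨ trans ⟩ *-cong (q^[+a*+b] k j) (q^[+a*+b] j j)) ⟩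
      q ^ℕ (k ℕ.* k) * (q ^ℕ (k ℕ.* i) * q ^ℕ (i ℕ.* i)) * (q ^ℕ (k ℕ.* j) * q ^ℕ (j ℕ.* j)) ∎
      where
      Q = quadraticForm (+ (k ℕ.+ i)) (+ (k ℕ.+ j))
      A = + k ℤ.* + k
      B = + k ℤ.* + i ℤ.+ + i ℤ.* + i
      C = + k ℤ.* + j ℤ.+ + j ℤ.* + j
      Q+ij≡A+B+C : Q ℤ.+ + i ℤ.* + j ≡ A ℤ.+ B ℤ.+ C
      Q+ij≡A+B+C = P.cong₂ (λ I J → quadraticForm I J ℤ.+ + i ℤ.* + j) (ℤ.pos-+ k i) (ℤ.pos-+ k j)
                   ⟨ P.trans ⟩ quadraticForm-shift (+ k) (+ i) (+ j)

  tailZ tailW : ℕ → Carrier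
  tailZ a = pochℕ (Z * q ^ℕ suc a) (N ℕ.∸ a) * pochℕ (x * q ^ℕ a) (N ℕ.∸ a)
  tailW b = pochℕ (W * q ^ℕ suc b) (M ℕ.∸ b) * pochℕ (x * q ^ℕ b) (M ℕ.∸ b)

  coefficient : ℕ → ℕ → Carrier
  coefficient a b = qBinomial N a * qBinomial M b * monomial a b * (tailZ a * tailW b)

  doubleSummand : ℕ → ℕ → Carrier
  doubleSummand a b = qBinomial N a * qBinomial M b * monomial a b * pochℕ x (a ℕ.+ b) * tailZ a * tailW b

  tripleSummand : ℕ → ℕ → ℕ → Carrier
  tripleSummand a b k = coefficient a b * (pochℕ x b * (qBinomial a k * vandermondeSummand a b x k))

  doubleSummand-expand : ∀ a b → a ℕ.≤ N → doubleSummand a b ≈ ∑< (suc N) (tripleSummand a b)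
  doubleSummand-expand a b a≤N = begin
    doubleSummand a b
      ≈⟨ solve 6 (λ p1 p2 p3 p4 p5 p6 → p1 :* p2 :* p3 :* p4 :* p5 :* p6 := p1 :* p2 :* p3 :* (p5 :* p6) :* p4) refl _ _ _ _ _ _ ⟩
    coefficient a b * pochℕ x (a ℕ.+ b)
      ≈⟨ *-congˡ (reflexive (P.cong (pochℕ x) (ℕ.+-comm a b)) ⟨ trans ⟩ pochℕ-+ x b a) ⟩
    coefficient a b * (pochℕ x b * pochℕ (x * q ^ℕ b) a)
      ≈⟨ *-congˡ (*-congˡ (q-vandermonde a b x)) ⟨
    coefficient a b * (pochℕ x b * ∑< (suc a) f)
      ≈⟨ *-congˡ (*-congˡ (∑-dropFinalZeros f (suc a) (suc N) (ℕ.s≤s a≤N) (λ k a<k _ → x≈0⇒x*y≈0 _ (qBinomial-zero a k a<k)))) ⟨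
    coefficient a b * (pochℕ x b * ∑< (suc N) f)
      ≈⟨ *-congˡ (*-distribˡ-∑ (pochℕ x b) f (suc N)) ⟩
    coefficient a b * ∑< (suc N) (λ k → pochℕ x b * f k)
      ≈⟨ *-distribˡ-∑ (coefficient a b) (λ k → pochℕ x b * f k) (suc N) ⟩
    ∑< (suc N) (tripleSummand a b) ∎
    where
    f : ℕ → Carrier
    f k = qBinomial a k * vandermondeSummand a b x k

  doubleSum-exchange : ∑< (suc N) (λ a → ∑< (suc M) (doubleSummand a))
                       ≈ ∑< (suc N) (λ k → ∑< (suc N) (λ a → ∑< (suc M) (λ b → tripleSummand a b k)))
  doubleSum-exchange = begin
    ∑< (suc N) (λ a → ∑< (suc M) (doubleSummand a))
      ≈⟨ ∑-cong (suc N) (λ a a≤N → ∑-cong (suc M) (λ b _ → doubleSummand-expand a b (ℕ.≤-pred a≤N))) ⟩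
    ∑< (suc N) (λ a → ∑< (suc M) (λ b → ∑< (suc N) (tripleSummand a b)))
      ≈⟨ ∑-cong (suc N) (λ a _ → ∑-comm (tripleSummand a) (suc M) (suc N)) ⟩
    ∑< (suc N) (λ a → ∑< (suc N) (λ k → ∑< (suc M) (λ b → tripleSummand a b k)))
      ≈⟨ ∑-comm (λ a k → ∑< (suc M) (λ b → tripleSummand a b k)) (suc N) (suc N) ⟩
    ∑< (suc N) (λ k → ∑< (suc N) (λ a → ∑< (suc M) (λ b → tripleSummand a b k))) ∎

  innerZ innerW : ℕ → ℕ → Carrier
  innerZ k i = qBinomial (N ℕ.∸ k) i * unitySummand (N ℕ.∸ k) (Z * q ^ℕ k) i
  innerW k j = qBinomial (M ℕ.∸ k) j * unitySummand (M ℕ.∸ k) (W * q ^ℕ k) j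

  diagonalTerm : ℕ → Carrier
  diagonalTerm k = qBinomial N k * shiftedPochSummand N M (Z * W) k * pochℕ x M

  tripleSummand-factorise : ∀ k i j → k ℕ.≤ M → i ℕ.≤ N ℕ.∸ k → j ℕ.≤ M ℕ.∸ k →
    tripleSummand (k ℕ.+ i) (k ℕ.+ j) k ≈ diagonalTerm k * (innerZ k i * innerW k j)
  tripleSummand-factorise k i j k≤M i≤N∸k j≤M∸k = begin
    tripleSummand a b k
      ≈⟨ solve 12 (λ bna bmb ea pz pxa pw pxb pxb′ bak dbk qij pxk →
            bna :* bmb :* ea :* ((pz :* pxa) :* (pw :* pxb)) :* (pxb′ :* (bak :* (dbk :* qij :* pxk)))
            := (bna :* bak) :* (bmb :* dbk) :* (ea :* qij) :* (pxk :* pxa) :* (pxb′ :* pxb) :* pz :* pw) refl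
           (qBinomial N a) (qBinomial M b) (monomial a b) (pochℕ (Z * q ^ℕ suc a) (N ℕ.∸ a)) (pochℕ (x * q ^ℕ a) (N ℕ.∸ a))
           (pochℕ (W * q ^ℕ suc b) (M ℕ.∸ b)) (pochℕ (x * q ^ℕ b) (M ℕ.∸ b)) (pochℕ x b) (qBinomial a k) (qFalling b k)
           (q ^ℕ ((a ℕ.∸ k) ℕ.* (b ℕ.∸ k))) (pochℕ (x * q ^ℕ k) (a ℕ.∸ k)) ⟩
    (qBinomial N a * qBinomial a k) * (qBinomial M b * qFalling b k) * (monomial a b * q ^ℕ ((a ℕ.∸ k) ℕ.* (b ℕ.∸ k)))
      * (pochℕ (x * q ^ℕ k) (a ℕ.∸ k) * pochℕ (x * q ^ℕ a) (N ℕ.∸ a)) * (pochℕ x b * pochℕ (x * q ^ℕ b) (M ℕ.∸ b))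
      * pochℕ (Z * q ^ℕ suc a) (N ℕ.∸ a) * pochℕ (W * q ^ℕ suc b) (M ℕ.∸ b)
      ≈⟨ *-cong (*-cong (*-cong (*-cong (*-cong (*-cong (qBinomial-*-qBinomial N k i) (qBinomial-*-qFalling M k j)) monomials) xq^k-tail) x-tail) Z-tail) W-tail ⟩
    (qBinomial N k * qBinomial (N ℕ.∸ k) i) * (qFalling M k * qBinomial (M ℕ.∸ k) j)
      * ((Z * W) ^ℕ k * q ^ℕ (k ℕ.* k) * ((Z * q ^ℕ k) ^ℕ i * q ^ℕ (i ℕ.* i)) * ((W * q ^ℕ k) ^ℕ j * q ^ℕ (j ℕ.* j)))
      * pochℕ (Z * W * q ^ℕ suc k) (N ℕ.∸ k) * pochℕ x M
      * pochℕ (Z * q ^ℕ k * q ^ℕ suc i) (N ℕ.∸ k ℕ.∸ i) * pochℕ (W * q ^ℕ k * q ^ℕ suc j) (M ℕ.∸ k ℕ.∸ j)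
      ≈⟨ solve 14 (λ bnk bnki dmk bmkj zwk qkk zqi qii wqj qjj pxk pxm pz pw →
            (bnk :* bnki) :* (dmk :* bmkj) :* (zwk :* qkk :* (zqi :* qii) :* (wqj :* qjj)) :* pxk :* pxm :* pz :* pw
            := bnk :* (dmk :* zwk :* qkk :* pxk) :* pxm :* ((bnki :* (zqi :* qii :* pz)) :* (bmkj :* (wqj :* qjj :* pw)))) refl
           (qBinomial N k) (qBinomial (N ℕ.∸ k) i) (qFalling M k) (qBinomial (M ℕ.∸ k) j) ((Z * W) ^ℕ k) (q ^ℕ (k ℕ.* k))
           ((Z * q ^ℕ k) ^ℕ i) (q ^ℕ (i ℕ.* i)) ((W * q ^ℕ k) ^ℕ j) (q ^ℕ (j ℕ.* j))
           (pochℕ (Z * W * q ^ℕ suc k) (N ℕ.∸ k)) (pochℕ x M) (pochℕ (Z * q ^ℕ k * q ^ℕ suc i) (N ℕ.∸ k ℕ.∸ i))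
           (pochℕ (W * q ^ℕ k * q ^ℕ suc j) (M ℕ.∸ k ℕ.∸ j)) ⟩
    diagonalTerm k * (innerZ k i * innerW k j) ∎
    where
    a = k ℕ.+ i
    b = k ℕ.+ j
    k+j≤M : k ℕ.+ j ℕ.≤ M
    k+j≤M = ℕ.+-monoʳ-≤ k j≤M∸k ⟨ ℕ.≤-trans ⟩ ℕ.≤-reflexive (ℕ.m+[n∸m]≡n k≤M)
    monomials : monomial a b * q ^ℕ ((a ℕ.∸ k) ℕ.* (b ℕ.∸ k))
                ≈ (Z * W) ^ℕ k * q ^ℕ (k ℕ.* k) * ((Z * q ^ℕ k) ^ℕ i * q ^ℕ (i ℕ.* i)) * ((W * q ^ℕ k) ^ℕ j * q ^ℕ (j ℕ.* j))
    monomials = *-congˡ (^ℕ-congʳ q (P.cong₂ ℕ._*_ (ℕ.m+n∸m≡n k i) (ℕ.m+n∸m≡n k j))) ⟨ trans ⟩ monomial-shift k i j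
    shift : ∀ Y l → Y * q ^ℕ suc (k ℕ.+ l) ≈ Y * q ^ℕ k * q ^ℕ suc l
    shift Y l = *-congˡ (^ℕ-congʳ q (P.sym (ℕ.+-suc k l)) ⟨ trans ⟩ ^ℕ-homo-+ q k (suc l)) ⟨ trans ⟩ sym (*-assoc _ _ _)
    xq^k-tail : pochℕ (x * q ^ℕ k) (a ℕ.∸ k) * pochℕ (x * q ^ℕ a) (N ℕ.∸ a) ≈ pochℕ (Z * W * q ^ℕ suc k) (N ℕ.∸ k)
    xq^k-tail = begin
      pochℕ (x * q ^ℕ k) (a ℕ.∸ k) * pochℕ (x * q ^ℕ a) (N ℕ.∸ a)
        ≈⟨ *-cong (reflexive (P.cong (pochℕ (x * q ^ℕ k)) (ℕ.m+n∸m≡n k i)))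
                  (pochℕ-cong (N ℕ.∸ a) (*-congˡ (^ℕ-homo-+ q k i) ⟨ trans ⟩ sym (*-assoc _ _ _))
                   ⟨ trans ⟩ reflexive (P.cong (pochℕ (x * q ^ℕ k * q ^ℕ i)) (P.sym (ℕ.∸-+-assoc N k i)))) ⟩
      pochℕ (x * q ^ℕ k) i * pochℕ (x * q ^ℕ k * q ^ℕ i) (N ℕ.∸ k ℕ.∸ i)
        ≈⟨ pochℕ-+ (x * q ^ℕ k) i (N ℕ.∸ k ℕ.∸ i) ⟨
      pochℕ (x * q ^ℕ k) (i ℕ.+ (N ℕ.∸ k ℕ.∸ i))
        ≡⟨ P.cong (pochℕ (x * q ^ℕ k)) (ℕ.m+[n∸m]≡n i≤N∸k) ⟩
      pochℕ (x * q ^ℕ k) (N ℕ.∸ k)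
        ≈⟨ pochℕ-cong (N ℕ.∸ k) (*-assoc _ _ _) ⟩
      pochℕ (Z * W * q ^ℕ suc k) (N ℕ.∸ k) ∎
    x-tail : pochℕ x b * pochℕ (x * q ^ℕ b) (M ℕ.∸ b) ≈ pochℕ x M
    x-tail = sym (pochℕ-+ x b (M ℕ.∸ b)) ⟨ trans ⟩ reflexive (P.cong (pochℕ x) (ℕ.m+[n∸m]≡n k+j≤M))
    Z-tail : pochℕ (Z * q ^ℕ suc a) (N ℕ.∸ a) ≈ pochℕ (Z * q ^ℕ k * q ^ℕ suc i) (N ℕ.∸ k ℕ.∸ i)
    Z-tail = pochℕ-cong (N ℕ.∸ a) (shift Z i) ⟨ trans ⟩ reflexive (P.cong (pochℕ (Z * q ^ℕ k * q ^ℕ suc i)) (P.sym (ℕ.∸-+-assoc N k i)))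
    W-tail : pochℕ (W * q ^ℕ suc b) (M ℕ.∸ b) ≈ pochℕ (W * q ^ℕ k * q ^ℕ suc j) (M ℕ.∸ k ℕ.∸ j)
    W-tail = pochℕ-cong (M ℕ.∸ b) (shift W j) ⟨ trans ⟩ reflexive (P.cong (pochℕ (W * q ^ℕ k * q ^ℕ suc j)) (P.sym (ℕ.∸-+-assoc M k j)))

  tripleSummand-vanishes : ∀ a b k → b ℕ.< k → tripleSummand a b k ≈ 0#
  tripleSummand-vanishes a b k b<k =
    y≈0⇒x*y≈0 _ (y≈0⇒x*y≈0 _ (y≈0⇒x*y≈0 _ (x≈0⇒x*y≈0 _ (x≈0⇒x*y≈0 _ (qFalling-zero b k b<k)))))

  tripleSum-fixedIndex : ∀ k → k ℕ.≤ N → ∑< (suc N) (λ a → ∑< (suc M) (λ b → tripleSummand a b k)) ≈ diagonalTerm k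
  tripleSum-fixedIndex k k≤N with ℕ.≤-<-connex k M
  ... | inj₂ M<k =
    ∑-zero {λ a → ∑< (suc M) (λ b → tripleSummand a b k)} (suc N) (λ a _ → ∑-zero {λ b → tripleSummand a b k} (suc M) (λ b b≤M → tripleSummand-vanishes a b k (ℕ.≤-pred b≤M ⟨ ℕ.≤-<-trans ⟩ M<k)))
    ⟨ trans ⟩ sym (x≈0⇒x*y≈0 _ (y≈0⇒x*y≈0 _ (x≈0⇒x*y≈0 _ (x≈0⇒x*y≈0 _ (x≈0⇒x*y≈0 _ (qFalling-zero M k M<k))))))
  ... | inj₁ k≤M = begin
    ∑< (suc N) (λ a → ∑< (suc M) (λ b → tripleSummand a b k))
      ≈⟨ ∑-from {λ a → ∑< (suc M) (λ b → tripleSummand a b k)} k≤N (λ a a<k → ∑-zero {λ b → tripleSummand a b k} (suc M) (λ b _ → y≈0⇒x*y≈0 _ (y≈0⇒x*y≈0 _ (x≈0⇒x*y≈0 _ (qBinomial-zero a k a<k))))) ⟩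
    ∑< (suc (N ℕ.∸ k)) (λ i → ∑< (suc M) (λ b → tripleSummand (k ℕ.+ i) b k))
      ≈⟨ ∑-cong (suc (N ℕ.∸ k)) (λ i _ → ∑-from {λ b → tripleSummand (k ℕ.+ i) b k} k≤M (λ b b<k → tripleSummand-vanishes (k ℕ.+ i) b k b<k)) ⟩
    ∑< (suc (N ℕ.∸ k)) (λ i → ∑< (suc (M ℕ.∸ k)) (λ j → tripleSummand (k ℕ.+ i) (k ℕ.+ j) k))
      ≈⟨ ∑-cong (suc (N ℕ.∸ k)) (λ i i≤ → ∑-cong (suc (M ℕ.∸ k)) (λ j j≤ →
           tripleSummand-factorise k i j k≤M (ℕ.≤-pred i≤) (ℕ.≤-pred j≤) ⟨ trans ⟩ sym (*-assoc _ _ _))) ⟩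
    ∑< (suc (N ℕ.∸ k)) (λ i → ∑< (suc (M ℕ.∸ k)) (λ j → diagonalTerm k * innerZ k i * innerW k j))
      ≈⟨ ∑-cong (suc (N ℕ.∸ k)) (λ i _ → sym (*-distribˡ-∑ (diagonalTerm k * innerZ k i) (innerW k) (suc (M ℕ.∸ k)))) ⟩
    ∑< (suc (N ℕ.∸ k)) (λ i → diagonalTerm k * innerZ k i * binomialSum (M ℕ.∸ k) (unitySummand (M ℕ.∸ k) (W * q ^ℕ k)))
      ≈⟨ ∑-cong (suc (N ℕ.∸ k)) (λ i _ → *-congˡ (q-partitionOfUnity (M ℕ.∸ k) (W * q ^ℕ k)) ⟨ trans ⟩ *-identityʳ (diagonalTerm k * innerZ k i)) ⟩
    ∑< (suc (N ℕ.∸ k)) (λ i → diagonalTerm k * innerZ k i)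
      ≈⟨ *-distribˡ-∑ (diagonalTerm k) (innerZ k) (suc (N ℕ.∸ k)) ⟨
    diagonalTerm k * binomialSum (N ℕ.∸ k) (unitySummand (N ℕ.∸ k) (Z * q ^ℕ k))
      ≈⟨ (*-congˡ (q-partitionOfUnity (N ℕ.∸ k) (Z * q ^ℕ k)) ⟨ trans ⟩ *-identityʳ _) ⟩
    diagonalTerm k ∎
    where
    ∑-from : ∀ {f L} → k ℕ.≤ L → (∀ i → i ℕ.< k → f i ≈ 0#) → ∑< (suc L) f ≈ ∑< (suc (L ℕ.∸ k)) (λ i → f (k ℕ.+ i))
    ∑-from {f} {L} k≤L f≈0 = ∑-dropInitialZeros f k (suc L) (ℕ.m≤n⇒m≤1+n k≤L) f≈0
                             ⟨ trans ⟩ reflexive (P.cong (λ l → ∑< l (λ i → f (k ℕ.+ i))) (ℕ.+-∸-assoc 1 k≤L))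

  doubleSum-identity : ∑< (suc N) (λ a → ∑< (suc M) (doubleSummand a)) ≈ pochℕ x (N ℕ.+ M)
  doubleSum-identity = begin
    ∑< (suc N) (λ a → ∑< (suc M) (doubleSummand a))
      ≈⟨ doubleSum-exchange ⟩
    ∑< (suc N) (λ k → ∑< (suc N) (λ a → ∑< (suc M) (λ b → tripleSummand a b k)))
      ≈⟨ ∑-cong (suc N) (λ k k≤N → tripleSum-fixedIndex k (ℕ.≤-pred k≤N) ⟨ trans ⟩ *-comm _ _) ⟩
    ∑< (suc N) (λ k → pochℕ x M * (qBinomial N k * shiftedPochSummand N M (Z * W) k))
      ≈⟨ *-distribˡ-∑ (pochℕ x M) (λ k → qBinomial N k * shiftedPochSummand N M (Z * W) k) (suc N) ⟨
    pochℕ x M * binomialSum N (shiftedPochSummand N M (Z * W))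
      ≈⟨ *-congˡ (shiftedPochExpansion N M (Z * W)) ⟩
    pochℕ x M * pochℕ (Z * W * q ^ℕ suc M) N
      ≈⟨ *-congˡ (pochℕ-cong N (*-assoc _ _ _)) ⟨
    pochℕ x M * pochℕ (x * q ^ℕ M) N
      ≈⟨ pochℕ-+ x M N ⟨
    pochℕ x (M ℕ.+ N)
      ≡⟨ P.cong (pochℕ x) (ℕ.+-comm M N) ⟩
    pochℕ x (N ℕ.+ M) ∎

module IntegerPochhammer {c ℓ : Level} (F : Field c ℓ) (z w q : Field.Carrier F)
  (q≉0 : FieldProperties.NonZero F q) where
  open Field F hiding (zero)
  open QSeries F z w q
  open FieldProperties F
  open Powers F z w q
  open Pochhammer F z w q

  NoZeroFactors : Carrier → Set ℓ
  NoZeroFactors α = ∀ j → NonZero (1# - α * q ^ℤ j)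

  α*q^u*q^k : ∀ α u k → α * q ^ℤ u * q ^ℕ k ≈ α * q ^ℤ (u ℤ.+ + k)
  α*q^u*q^k α u k = *-assoc _ _ _ ⟨ trans ⟩ *-congˡ (sym (^ℤ-homo-+ q≉0 u (+ k)))

  noZeroFactors-*q : ∀ α → NoZeroFactors α → NoZeroFactors (α * q)
  noZeroFactors-*q α α-ok j = nonZero-resp (+-congˡ (-‿cong (sym αq*q^j))) (α-ok (+ 1 ℤ.+ j))
    where
    αq*q^j : α * q * q ^ℤ j ≈ α * q ^ℤ (+ 1 ℤ.+ j)
    αq*q^j = *-assoc _ _ _ ⟨ trans ⟩ *-congˡ (*-congʳ (sym (*-identityʳ q)) ⟨ trans ⟩ sym (^ℤ-homo-+ q≉0 (+ 1) j))

  module _ {α : Carrier} (α-ok : NoZeroFactors α) where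

    pochℕ-shifted-nonZero : ∀ u k → NonZero (pochℕ (α * q ^ℤ u) k)
    pochℕ-shifted-nonZero u k =
      pochℕ-nonZero (α * q ^ℤ u) k (λ j → nonZero-resp (+-congˡ (-‿cong (sym (α*q^u*q^k α u j)))) (α-ok (u ℤ.+ + j)))

    poch-nonZero : ∀ i → NonZero (poch α i)
    poch-nonZero (+ n)    = pochℕ-nonZero α n (λ j → α-ok (+ j))
    poch-nonZero -[1+ n ] = ⁻¹-nonZero (pochℕ-shifted-nonZero -[1+ n ] (suc n))

    recipPoch≈poch⁻¹ : ∀ i → recipPoch α i ≈ (poch α i) ⁻¹
    recipPoch≈poch⁻¹ (+ n)    = refl
    recipPoch≈poch⁻¹ -[1+ n ] = sym (⁻¹-involutive (pochℕ-shifted-nonZero -[1+ n ] (suc n)))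

    poch-suc : ∀ i → poch α (i ℤ.+ + 1) ≈ poch α i * (1# - α * q ^ℤ i)
    poch-suc (+ n)          = reflexive (P.cong (pochℕ α) (ℕ.+-comm n 1))
    poch-suc -[1+ zero ]    = sym (*-congʳ (⁻¹-cong (nonZero-resp (sym β-form) (α-ok -[1+ 0 ])) β-form) ⟨ trans ⟩ ⁻¹-inverseˡ (α-ok -[1+ 0 ]))
      where
      β-form : 1# * (1# - α * q ^ℤ -[1+ 0 ] * 1#) ≈ 1# - α * q ^ℤ -[1+ 0 ]
      β-form = *-identityˡ _ ⟨ trans ⟩ +-congˡ (-‿cong (*-identityʳ _))
    poch-suc -[1+ suc n ] = sym (begin
      (pochℕ β (suc (suc n))) ⁻¹ * (1# - β)
        ≈⟨ *-congʳ (⁻¹-cong (pochℕ-shifted-nonZero -[1+ suc n ] (suc (suc n))) (pochℕ-suc β (suc n) ⟨ trans ⟩ *-congˡ (pochℕ-cong (suc n) β*q≈γ))) ⟩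
      ((1# - β) * pochℕ γ (suc n)) ⁻¹ * (1# - β)
        ≈⟨ *-congʳ (⁻¹-distrib-* (α-ok -[1+ suc n ]) (pochℕ-shifted-nonZero -[1+ n ] (suc n))) ⟩
      ((1# - β) ⁻¹ * (pochℕ γ (suc n)) ⁻¹) * (1# - β)
        ≈⟨ solve 3 (λ a b c → a :* b :* c := a :* c :* b) refl _ _ _ ⟩
      ((1# - β) ⁻¹ * (1# - β)) * (pochℕ γ (suc n)) ⁻¹
        ≈⟨ (*-congʳ (⁻¹-inverseˡ (α-ok -[1+ suc n ])) ⟨ trans ⟩ *-identityˡ _) ⟩
      (pochℕ γ (suc n)) ⁻¹ ∎)
      where
      β = α * q ^ℤ -[1+ suc n ]
      γ = α * q ^ℤ -[1+ n ]
      β*q≈γ : β * q ≈ γ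
      β*q≈γ = *-assoc _ _ _ ⟨ trans ⟩ *-congˡ (solve 3 (λ a b c → a :* b :* c := b :* (a :* c)) refl (q ⁻¹) ((q ⁻¹) ^ℕ suc n) q
                                                 ⟨ trans ⟩ *-congˡ (⁻¹-inverseˡ q≉0) ⟨ trans ⟩ *-identityʳ _)

    poch-+ : ∀ u k → poch α (u ℤ.+ + k) ≈ poch α u * pochℕ (α * q ^ℤ u) k
    poch-+ u zero    = reflexive (P.cong (poch α) (ℤ.+-identityʳ u)) ⟨ trans ⟩ sym (*-identityʳ _)
    poch-+ u (suc k) = begin
      poch α (u ℤ.+ + suc k)                                      ≡⟨ P.cong (poch α) u+[1+k]≡u+k+1 ⟩
      poch α (u ℤ.+ + k ℤ.+ + 1)                                  ≈⟨ poch-suc (u ℤ.+ + k) ⟩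
      poch α (u ℤ.+ + k) * (1# - α * q ^ℤ (u ℤ.+ + k))            ≈⟨ *-cong (poch-+ u k) (+-congˡ (-‿cong (sym (α*q^u*q^k α u k)))) ⟩
      poch α u * pochℕ (α * q ^ℤ u) k * (1# - α * q ^ℤ u * q ^ℕ k) ≈⟨ *-assoc _ _ _ ⟩
      poch α u * pochℕ (α * q ^ℤ u) (suc k)                       ∎
      where
      u+[1+k]≡u+k+1 : u ℤ.+ + suc k ≡ u ℤ.+ + k ℤ.+ + 1
      u+[1+k]≡u+k+1 = P.cong (λ t → u ℤ.+ t) (P.cong +_ (ℕ.+-comm 1 k) ⟨ P.trans ⟩ ℤ.pos-+ k 1) ⟨ P.trans ⟩ P.sym (ℤ.+-assoc u (+ k) (+ 1))

    recipPoch-+ : ∀ u k → recipPoch α (u ℤ.+ + k) ≈ recipPoch α u * (pochℕ (α * q ^ℤ u) k) ⁻¹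
    recipPoch-+ u k = begin
      recipPoch α (u ℤ.+ + k)                     ≈⟨ recipPoch≈poch⁻¹ (u ℤ.+ + k) ⟩
      (poch α (u ℤ.+ + k)) ⁻¹                     ≈⟨ ⁻¹-cong (poch-nonZero (u ℤ.+ + k)) (poch-+ u k) ⟩
      (poch α u * pochℕ (α * q ^ℤ u) k) ⁻¹        ≈⟨ ⁻¹-distrib-* (poch-nonZero u) (pochℕ-shifted-nonZero u k) ⟩
      (poch α u) ⁻¹ * (pochℕ (α * q ^ℤ u) k) ⁻¹   ≈⟨ *-congʳ (recipPoch≈poch⁻¹ u) ⟨
      recipPoch α u * (pochℕ (α * q ^ℤ u) k) ⁻¹   ∎

  -- recipPoch q -[1+ k ] is (q^{-k};q)_{k+1}, whose last factor is 1 - q^{-k} q^k = 0.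
  recipPoch-q-negative : ∀ k → recipPoch q -[1+ k ] ≈ 0#
  recipPoch-q-negative k = y≈0⇒x*y≈0 _ (+-congˡ (-‿cong last-factor≈1) ⟨ trans ⟩ -‿inverseʳ 1#)
    where
    last-factor≈1 : q * q ^ℤ -[1+ k ] * q ^ℕ k ≈ 1#
    last-factor≈1 = begin
      q * q ^ℤ -[1+ k ] * q ^ℕ k              ≈⟨ *-congʳ (*-congʳ (*-identityʳ q)) ⟨
      q ^ℤ (+ 1) * q ^ℤ -[1+ k ] * q ^ℤ (+ k) ≈⟨ *-congʳ (^ℤ-homo-+ q≉0 (+ 1) -[1+ k ]) ⟨
      q ^ℤ (+ 1 ℤ.+ -[1+ k ]) * q ^ℤ (+ k)    ≈⟨ ^ℤ-homo-+ q≉0 (+ 1 ℤ.+ -[1+ k ]) (+ k) ⟨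
      q ^ℤ (+ 1 ℤ.+ -[1+ k ] ℤ.+ + k)         ≡⟨ P.cong (q ^ℤ_) (1+[-1-k]+k≡0 (+ k)) ⟩
      1#                                      ∎
      where
      1+[-1-k]+k≡0 : ∀ K → + 1 ℤ.+ ℤ.- (+ 1 ℤ.+ K) ℤ.+ K ≡ + 0
      1+[-1-k]+k≡0 = ZS.solve-∀

  pochℕ⁻¹-extend : ∀ β a N → a ℕ.≤ N → NonZero (pochℕ β a) → NonZero (pochℕ β N) →
                   (pochℕ β a) ⁻¹ ≈ (pochℕ β N) ⁻¹ * pochℕ (β * q ^ℕ a) (N ℕ.∸ a)
  pochℕ⁻¹-extend β a N a≤N βa≉0 βN≉0 = begin
    (pochℕ β a) ⁻¹
      ≈⟨ (*-congʳ (⁻¹-inverseˡ βN≉0) ⟨ trans ⟩ *-identityˡ _) ⟨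
    ((pochℕ β N) ⁻¹ * pochℕ β N) * (pochℕ β a) ⁻¹
      ≈⟨ *-congʳ (*-congˡ (reflexive (P.cong (pochℕ β) (P.sym (ℕ.m+[n∸m]≡n a≤N))) ⟨ trans ⟩ pochℕ-+ β a (N ℕ.∸ a))) ⟩
    ((pochℕ β N) ⁻¹ * (pochℕ β a * R)) * (pochℕ β a) ⁻¹
      ≈⟨ solve 4 (λ i p r j → i :* (p :* r) :* j := i :* r :* (p :* j)) refl _ _ _ _ ⟩
    (pochℕ β N) ⁻¹ * R * (pochℕ β a * (pochℕ β a) ⁻¹)
      ≈⟨ (*-congˡ (⁻¹-inverse _ βa≉0) ⟨ trans ⟩ *-identityʳ _) ⟩
    (pochℕ β N) ⁻¹ * R ∎
    where R = pochℕ (β * q ^ℕ a) (N ℕ.∸ a)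

  recipPoch-+-extend : ∀ {α} → NoZeroFactors α → ∀ t k L → k ℕ.≤ L →
    recipPoch α (t ℤ.+ + k) ≈ recipPoch α t * ((pochℕ (α * q ^ℤ t) L) ⁻¹ * pochℕ (α * q ^ℤ t * q ^ℕ k) (L ℕ.∸ k))
  recipPoch-+-extend α-ok t k L k≤L = recipPoch-+ α-ok t k ⟨ trans ⟩
    *-congˡ (pochℕ⁻¹-extend _ k L k≤L (pochℕ-shifted-nonZero α-ok t k) (pochℕ-shifted-nonZero α-ok t L))

module IntegerRanges {c ℓ : Level} (F : Field c ℓ) (z w q : Field.Carrier F) where
  open Field F hiding (zero)
  open QSeries F z w q
  open FieldProperties F

  sumFrom≈∑ : ∀ f a len → sumFrom f a len ≈ ∑< len (λ i → f (a ℤ.+ + i))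
  sumFrom≈∑ f a zero      = refl
  sumFrom≈∑ f a (suc len) = +-cong (reflexive (P.cong f (P.sym (ℤ.+-identityʳ a))))
    (sumFrom≈∑ f (a ℤ.+ + 1) len ⟨ trans ⟩ ∑-cong len (λ i _ → reflexive (P.cong f (a+1+i≡a+[1+i] i))))
    where
    a+1+i≡a+[1+i] : ∀ i → a ℤ.+ + 1 ℤ.+ + i ≡ a ℤ.+ + suc i
    a+1+i≡a+[1+i] i = ℤ.+-assoc a (+ 1) (+ i) ⟨ P.trans ⟩ P.cong (λ t → a ℤ.+ t) (P.sym (ℤ.pos-+ 1 i))

  rangeLength-+ : ∀ a b k → b ℤ.- a ≡ + k → rangeLength a b ≡ suc k
  rangeLength-+ a b k eq with b ℤ.- a
  rangeLength-+ a b k P.refl | .(+ k) = P.refl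

  rangeLength-neg : ∀ a b k → b ℤ.- a ≡ -[1+ k ] → rangeLength a b ≡ 0
  rangeLength-neg a b k eq with b ℤ.- a
  rangeLength-neg a b k P.refl | .(-[1+ k ]) = P.refl

  sumRange-from : ∀ a N f → sumRange a (a ℤ.+ + N) f ≈ ∑< (suc N) (λ i → f (a ℤ.+ + i))
  sumRange-from a N f = reflexive (P.cong (sumFrom f a) (rangeLength-+ a (a ℤ.+ + N) N ([a+k]-a≡k a (+ N))))
                        ⟨ trans ⟩ sumFrom≈∑ f a (suc N)
    where
    [a+k]-a≡k : ∀ a k → a ℤ.+ k ℤ.- a ≡ k
    [a+k]-a≡k = ZS.solve-∀

  sumRange-empty : ∀ a b f k → b ℤ.- a ≡ -[1+ k ] → sumRange a b f ≈ 0#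
  sumRange-empty a b f k eq = reflexive (P.cong (sumFrom f a) (rangeLength-neg a b k eq))

square≡+ : ∀ i → i ℤ.* i ≡ + (∣ i ∣ ℕ.* ∣ i ∣)
square≡+ i = P.cong (_◃ (∣ i ∣ ℕ.* ∣ i ∣)) (Sign.s*s≡+ (sign i)) ⟨ P.trans ⟩ ℤ.+◃n≡+n _

half-of-double : ∀ H s → H ℤ.+ H ≡ + s → + (s ℕ./ 2) ≡ H
half-of-double (+ h)    s h+h≡s = P.cong +_ (begin
  s ℕ./ 2          ≡⟨ P.cong (ℕ._/ 2) (ℤ.+-injective h+h≡s) ⟨
  (h ℕ.+ h) ℕ./ 2  ≡⟨ P.cong (λ t → (h ℕ.+ t) ℕ./ 2) (ℕ.+-identityʳ h) ⟨
  (2 ℕ.* h) ℕ./ 2  ≡⟨ P.cong (ℕ._/ 2) (ℕ.*-comm 2 h) ⟩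
  (h ℕ.* 2) ℕ./ 2  ≡⟨ ℕ.m*n/n≡m h 2 ⟩
  h                ∎)
  where open P.≡-Reasoning
half-of-double -[1+ k ] s ()

halfSumOfSquares : ∀ y₁ y₂ → + (∣ y₁ ℤ.* y₁ ℤ.+ y₂ ℤ.* y₂ ℤ.+ (ℤ.- (y₁ ℤ.+ y₂)) ℤ.* (ℤ.- (y₁ ℤ.+ y₂)) ∣ ℕ./ 2)
                             ≡ y₁ ℤ.* y₁ ℤ.+ y₁ ℤ.* y₂ ℤ.+ y₂ ℤ.* y₂
halfSumOfSquares y₁ y₂ =
  P.cong (λ t → + (∣ t ∣ ℕ./ 2)) sum≡+ ⟨ P.trans ⟩ half-of-double _ _ (P.sym (sum≡double y₁ y₂) ⟨ P.trans ⟩ sum≡+)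
  where
  y₃ = ℤ.- (y₁ ℤ.+ y₂)
  sum≡double : ∀ y₁ y₂ → y₁ ℤ.* y₁ ℤ.+ y₂ ℤ.* y₂ ℤ.+ (ℤ.- (y₁ ℤ.+ y₂)) ℤ.* (ℤ.- (y₁ ℤ.+ y₂))
               ≡ (y₁ ℤ.* y₁ ℤ.+ y₁ ℤ.* y₂ ℤ.+ y₂ ℤ.* y₂) ℤ.+ (y₁ ℤ.* y₁ ℤ.+ y₁ ℤ.* y₂ ℤ.+ y₂ ℤ.* y₂)
  sum≡double = ZS.solve-∀
  sum≡+ : y₁ ℤ.* y₁ ℤ.+ y₂ ℤ.* y₂ ℤ.+ y₃ ℤ.* y₃ ≡ + (∣ y₁ ∣ ℕ.* ∣ y₁ ∣ ℕ.+ ∣ y₂ ∣ ℕ.* ∣ y₂ ∣ ℕ.+ ∣ y₃ ∣ ℕ.* ∣ y₃ ∣)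
  sum≡+ = P.cong₂ ℤ._+_ (P.cong₂ ℤ._+_ (square≡+ y₁) (square≡+ y₂)) (square≡+ y₃)
          ⟨ P.trans ⟩ P.sym (ℤ.pos-+ (s₁ ℕ.+ s₂) s₃ ⟨ P.trans ⟩ P.cong (ℤ._+ + s₃) (ℤ.pos-+ s₁ s₂))
    where
    s₁ = ∣ y₁ ∣ ℕ.* ∣ y₁ ∣
    s₂ = ∣ y₂ ∣ ℕ.* ∣ y₂ ∣
    s₃ = ∣ y₃ ∣ ℕ.* ∣ y₃ ∣

module IndexArithmetic where
  [a+k]-a≡k : ∀ a k → a ℤ.+ k ℤ.- a ≡ k
  [a+k]-a≡k = ZS.solve-∀

  [a+k]-[a+j]≡k-j : ∀ a k j → (a ℤ.+ k) ℤ.- (a ℤ.+ j) ≡ k ℤ.- j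
  [a+k]-[a+j]≡k-j = ZS.solve-∀

  [y₁+k]-y₂≡u+k : ∀ y₁ y₂ k → (y₁ ℤ.+ k) ℤ.- y₂ ≡ (y₁ ℤ.- y₂) ℤ.+ k
  [y₁+k]-y₂≡u+k = ZS.solve-∀

  [y₁+k]-y₃≡c+k : ∀ y₁ y₂ k → (y₁ ℤ.+ k) ℤ.- (ℤ.- (y₁ ℤ.+ y₂)) ≡ (y₁ ℤ.+ y₁ ℤ.+ y₂) ℤ.+ k
  [y₁+k]-y₃≡c+k = ZS.solve-∀

  [y₁+y₂+k]+y₃≡k : ∀ y₁ y₂ k → (y₁ ℤ.+ y₂ ℤ.+ k) ℤ.+ (ℤ.- (y₁ ℤ.+ y₂)) ≡ k
  [y₁+y₂+k]+y₃≡k = ZS.solve-∀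

  [y₁+y₂+k]+y₂≡v+k : ∀ y₁ y₂ k → (y₁ ℤ.+ y₂ ℤ.+ k) ℤ.+ y₂ ≡ (y₁ ℤ.+ y₂ ℤ.+ y₂) ℤ.+ k
  [y₁+y₂+k]+y₂≡v+k = ZS.solve-∀

  [y₁+y₂+k]+y₁≡c+k : ∀ y₁ y₂ k → (y₁ ℤ.+ y₂ ℤ.+ k) ℤ.+ y₁ ≡ (y₁ ℤ.+ y₁ ℤ.+ y₂) ℤ.+ k
  [y₁+y₂+k]+y₁≡c+k = ZS.solve-∀

  [y₁+k]+[y₁+y₂+j]≡c+[k+j] : ∀ y₁ y₂ k j → (y₁ ℤ.+ k) ℤ.+ (y₁ ℤ.+ y₂ ℤ.+ j) ≡ (y₁ ℤ.+ y₁ ℤ.+ y₂) ℤ.+ (k ℤ.+ j)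
  [y₁+k]+[y₁+y₂+j]≡c+[k+j] = ZS.solve-∀

  c≡u+v : ∀ y₁ y₂ → y₁ ℤ.+ y₁ ℤ.+ y₂ ≡ (y₁ ℤ.- y₂) ℤ.+ (y₁ ℤ.+ y₂ ℤ.+ y₂)
  c≡u+v = ZS.solve-∀

  -- The exponent of 𝒦 at (r, s) = (y₁ + A, y₁ + y₂ + B).
  quadraticForm-reindex : ∀ y₁ y₂ A B →
    (y₁ ℤ.+ A) ℤ.* (y₁ ℤ.+ A) ℤ.- (y₁ ℤ.+ A) ℤ.* (y₁ ℤ.+ y₂ ℤ.+ B) ℤ.+ (y₁ ℤ.+ y₂ ℤ.+ B) ℤ.* (y₁ ℤ.+ y₂ ℤ.+ B)
    ≡ (y₁ ℤ.* y₁ ℤ.+ y₁ ℤ.* y₂ ℤ.+ y₂ ℤ.* y₂)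
      ℤ.+ (A ℤ.* (y₁ ℤ.- y₂) ℤ.+ (B ℤ.* (y₁ ℤ.+ y₂ ℤ.+ y₂) ℤ.+ (A ℤ.* A ℤ.- A ℤ.* B ℤ.+ B ℤ.* B)))
  quadraticForm-reindex = ZS.solve-∀

  +L-+a≡+[L∸a] : ∀ a L → a ℕ.≤ L → + L ℤ.- + a ≡ + (L ℕ.∸ a)
  +L-+a≡+[L∸a] a L a≤L = ℤ.[+m]-[+n]≡m⊖n L a ⟨ P.trans ⟩ ℤ.⊖-≥ a≤L

module MainIdentity {c ℓ : Level} (F : Field c ℓ) (z w q : Field.Carrier F)
  (q≉0 : FieldProperties.NonZero F q) where
  open Field F hiding (zero)
  open QSeries F z w q
  open FieldProperties F
  open Powers F z w q
  open Pochhammer F z w q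
  open IntegerPochhammer F z w q q≉0
  open IntegerRanges F z w q
  open IndexArithmetic

  Φ-vanishes-n : ∀ n m y₁ y₂ y₃ k → n ℤ.- y₁ ≡ -[1+ k ] → Φ n m y₁ y₂ y₃ ≈ 0#
  Φ-vanishes-n n m y₁ y₂ y₃ k eq = x≈0⇒x*y≈0 _ (x≈0⇒x*y≈0 _ (x≈0⇒x*y≈0 _ (x≈0⇒x*y≈0 _ (x≈0⇒x*y≈0 _
    (y≈0⇒x*y≈0 _ (reflexive (P.cong (recipPoch q) eq) ⟨ trans ⟩ recipPoch-q-negative k))))))

  Φ-vanishes-m : ∀ n m y₁ y₂ y₃ k → m ℤ.+ y₃ ≡ -[1+ k ] → Φ n m y₁ y₂ y₃ ≈ 0#
  Φ-vanishes-m n m y₁ y₂ y₃ k eq = x≈0⇒x*y≈0 _ (x≈0⇒x*y≈0 _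
    (y≈0⇒x*y≈0 _ (reflexive (P.cong (recipPoch q) eq) ⟨ trans ⟩ recipPoch-q-negative k)))

  module Hypotheses
    (1-q^j≉0 : ∀ j → ¬ (j ≡ + 0) → NonZero (1# - q ^ℤ j))
    (z≉0 : NonZero z) (w≉0 : NonZero w)
    (z-ok : NoZeroFactors z) (w-ok : NoZeroFactors w) (zw-ok : NoZeroFactors (z * w)) where

    1-q^[1+j]≉0 : ∀ j → NonZero (1# - q ^ℕ suc j)
    1-q^[1+j]≉0 j = 1-q^j≉0 (+ suc j) (λ ())

    open GaussianBinomial F z w q 1-q^[1+j]≉0

    module Shifted (y₁ y₂ : ℤ) (N M : ℕ) where
      u v c′ H : ℤ
      u  = y₁ ℤ.- y₂
      v  = y₁ ℤ.+ y₂ ℤ.+ y₂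
      c′ = y₁ ℤ.+ y₁ ℤ.+ y₂
      H  = y₁ ℤ.* y₁ ℤ.+ y₁ ℤ.* y₂ ℤ.+ y₂ ℤ.* y₂

      Z W : Carrier
      Z = z * q ^ℤ u
      W = w * q ^ℤ v

      open DoubleSum F z w q 1-q^[1+j]≉0 q≉0 Z W N M public

      n m y₃ : ℤ
      n  = y₁ ℤ.+ + N
      m  = y₁ ℤ.+ y₂ ℤ.+ + M
      y₃ = ℤ.- (y₁ ℤ.+ y₂)

      zq wq zwq : Carrier
      zq  = z * q
      wq  = w * q
      zwq = z * w * q

      zq-ok : NoZeroFactors zq
      zq-ok = noZeroFactors-*q z z-ok
      wq-ok : NoZeroFactors wq
      wq-ok = noZeroFactors-*q w w-ok
      zwq-ok : NoZeroFactors zwq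
      zwq-ok = noZeroFactors-*q (z * w) zw-ok

      zq*q^u≈Z*q : zq * q ^ℤ u ≈ Z * q
      zq*q^u≈Z*q = solve 3 (λ a b d → a :* b :* d := a :* d :* b) refl z q (q ^ℤ u)
      wq*q^v≈W*q : wq * q ^ℤ v ≈ W * q
      wq*q^v≈W*q = solve 3 (λ a b d → a :* b :* d := a :* d :* b) refl w q (q ^ℤ v)
      zwq*q^c′≈x : zwq * q ^ℤ c′ ≈ x
      zwq*q^c′≈x = *-congˡ (^ℤ-congʳ q (c≡u+v y₁ y₂) ⟨ trans ⟩ ^ℤ-homo-+ q≉0 u v)
                   ⟨ trans ⟩ solve 5 (λ a b d e f → a :* b :* d :* (e :* f) := a :* e :* (b :* f) :* d) refl z w q (q ^ℤ u) (q ^ℤ v)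

      IZ IxN IW IxM : Carrier
      IZ  = (pochℕ (zq * q ^ℤ u) N) ⁻¹
      IxN = (pochℕ (zwq * q ^ℤ c′) N) ⁻¹
      IW  = (pochℕ (wq * q ^ℤ v) M) ⁻¹
      IxM = (pochℕ (zwq * q ^ℤ c′) M) ⁻¹

      prefactor shiftFactor normaliser : Carrier
      prefactor   = z ^ℤ y₁ * w ^ℤ (y₁ ℤ.+ y₂) * q ^ℤ H
      shiftFactor = poch zwq c′ * recipPoch zq u * recipPoch zwq c′ * recipPoch wq v * recipPoch zwq c′
      normaliser  = qFactorial⁻¹ N * IZ * IxN * qFactorial⁻¹ M * IW * IxM

      Φ-corner : Φ n m y₁ y₂ y₃ ≈ shiftFactor * normaliser * pochℕ x (N ℕ.+ M)
      Φ-corner = begin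
        poch zwq (n ℤ.+ m) * recipPoch q (n ℤ.- y₁) * recipPoch zq (n ℤ.- y₂) * recipPoch zwq (n ℤ.- y₃)
          * recipPoch q (m ℤ.+ y₃) * recipPoch wq (m ℤ.+ y₂) * recipPoch zwq (m ℤ.+ y₁)
          ≈⟨ *-cong (*-cong (*-cong (*-cong (*-cong (*-cong f₁ f₂) f₃) f₄) f₅) f₆) f₇ ⟩
        (poch zwq c′ * pochℕ x (N ℕ.+ M)) * qFactorial⁻¹ N * (recipPoch zq u * IZ) * (recipPoch zwq c′ * IxN)
          * qFactorial⁻¹ M * (recipPoch wq v * IW) * (recipPoch zwq c′ * IxM)
          ≈⟨ solve 12 (λ a b d e f g h i j k l o → (a :* b) :* d :* (e :* f) :* (g :* h) :* i :* (j :* k) :* (l :* o)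
                         := a :* e :* g :* j :* l :* (d :* f :* h :* i :* k :* o) :* b) refl
               (poch zwq c′) (pochℕ x (N ℕ.+ M)) (qFactorial⁻¹ N) (recipPoch zq u) IZ (recipPoch zwq c′) IxN
               (qFactorial⁻¹ M) (recipPoch wq v) IW (recipPoch zwq c′) IxM ⟩
        shiftFactor * normaliser * pochℕ x (N ℕ.+ M) ∎
        where
        f₁ : poch zwq (n ℤ.+ m) ≈ poch zwq c′ * pochℕ x (N ℕ.+ M)
        f₁ = reflexive (P.cong (poch zwq) ([y₁+k]+[y₁+y₂+j]≡c+[k+j] y₁ y₂ (+ N) (+ M) ⟨ P.trans ⟩ P.cong (λ t → c′ ℤ.+ t) (P.sym (ℤ.pos-+ N M))))
             ⟨ trans ⟩ poch-+ zwq-ok c′ (N ℕ.+ M) ⟨ trans ⟩ *-congˡ (pochℕ-cong (N ℕ.+ M) zwq*q^c′≈x)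
        f₂ : recipPoch q (n ℤ.- y₁) ≈ qFactorial⁻¹ N
        f₂ = reflexive (P.cong (recipPoch q) ([a+k]-a≡k y₁ (+ N)))
        f₃ : recipPoch zq (n ℤ.- y₂) ≈ recipPoch zq u * IZ
        f₃ = reflexive (P.cong (recipPoch zq) ([y₁+k]-y₂≡u+k y₁ y₂ (+ N))) ⟨ trans ⟩ recipPoch-+ zq-ok u N
        f₄ : recipPoch zwq (n ℤ.- y₃) ≈ recipPoch zwq c′ * IxN
        f₄ = reflexive (P.cong (recipPoch zwq) ([y₁+k]-y₃≡c+k y₁ y₂ (+ N))) ⟨ trans ⟩ recipPoch-+ zwq-ok c′ N
        f₅ : recipPoch q (m ℤ.+ y₃) ≈ qFactorial⁻¹ M
        f₅ = reflexive (P.cong (recipPoch q) ([y₁+y₂+k]+y₃≡k y₁ y₂ (+ M)))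
        f₆ : recipPoch wq (m ℤ.+ y₂) ≈ recipPoch wq v * IW
        f₆ = reflexive (P.cong (recipPoch wq) ([y₁+y₂+k]+y₂≡v+k y₁ y₂ (+ M))) ⟨ trans ⟩ recipPoch-+ wq-ok v M
        f₇ : recipPoch zwq (m ℤ.+ y₁) ≈ recipPoch zwq c′ * IxM
        f₇ = reflexive (P.cong (recipPoch zwq) ([y₁+y₂+k]+y₁≡c+k y₁ y₂ (+ M))) ⟨ trans ⟩ recipPoch-+ zwq-ok c′ M

      module _ (a b : ℕ) (a≤N : a ℕ.≤ N) (b≤M : b ℕ.≤ M) where
        r s : ℤ
        r = y₁ ℤ.+ + a
        s = y₁ ℤ.+ y₂ ℤ.+ + b

        𝒦-reindex : 𝒦 n m r s ≈ prefactor * monomial a b * (qFactorial⁻¹ N * qFalling N a) * (qFactorial⁻¹ M * qFalling M b)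
        𝒦-reindex = begin
          z ^ℤ r * w ^ℤ s * q ^ℤ (r ℤ.* r ℤ.- r ℤ.* s ℤ.+ s ℤ.* s) * recipPoch q (n ℤ.- r) * recipPoch q (m ℤ.- s)
            ≈⟨ *-cong (*-cong (*-cong (*-cong (^ℤ-homo-+ z≉0 y₁ (+ a)) (^ℤ-homo-+ w≉0 (y₁ ℤ.+ y₂) (+ b))) q-power) (recip y₁ N a a≤N)) (recip (y₁ ℤ.+ y₂) M b b≤M) ⟩
          z ^ℤ y₁ * z ^ℕ a * (w ^ℤ (y₁ ℤ.+ y₂) * w ^ℕ b) * (q ^ℤ H * ((q ^ℤ u) ^ℕ a * ((q ^ℤ v) ^ℕ b * q ^ℤ Q)))
            * (qFactorial⁻¹ N * qFalling N a) * (qFactorial⁻¹ M * qFalling M b)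
            ≈⟨ solve 12 (λ zy za wy wb qH qua qvb qQ iN dN iM dM →
                   zy :* za :* (wy :* wb) :* (qH :* (qua :* (qvb :* qQ))) :* (iN :* dN) :* (iM :* dM)
                   := zy :* wy :* qH :* (za :* qua :* (wb :* qvb) :* qQ) :* (iN :* dN) :* (iM :* dM)) refl
                 (z ^ℤ y₁) (z ^ℕ a) (w ^ℤ (y₁ ℤ.+ y₂)) (w ^ℕ b) (q ^ℤ H) ((q ^ℤ u) ^ℕ a) ((q ^ℤ v) ^ℕ b) (q ^ℤ Q)
                 (qFactorial⁻¹ N) (qFalling N a) (qFactorial⁻¹ M) (qFalling M b) ⟩
          prefactor * (z ^ℕ a * (q ^ℤ u) ^ℕ a * (w ^ℕ b * (q ^ℤ v) ^ℕ b) * q ^ℤ Q)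
            * (qFactorial⁻¹ N * qFalling N a) * (qFactorial⁻¹ M * qFalling M b)
            ≈⟨ *-congʳ (*-congʳ (*-congˡ (*-congʳ (*-cong (^ℕ-distrib-* z (q ^ℤ u) a) (^ℕ-distrib-* w (q ^ℤ v) b))))) ⟨
          prefactor * monomial a b * (qFactorial⁻¹ N * qFalling N a) * (qFactorial⁻¹ M * qFalling M b) ∎
          where
          Q = quadraticForm (+ a) (+ b)
          q-power : q ^ℤ (r ℤ.* r ℤ.- r ℤ.* s ℤ.+ s ℤ.* s) ≈ q ^ℤ H * ((q ^ℤ u) ^ℕ a * ((q ^ℤ v) ^ℕ b * q ^ℤ Q))
          q-power = ^ℤ-congʳ q (quadraticForm-reindex y₁ y₂ (+ a) (+ b))
                    ⟨ trans ⟩ ^ℤ-homo-+ q≉0 H _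
                    ⟨ trans ⟩ *-congˡ (^ℤ-homo-+ q≉0 (+ a ℤ.* u) _
                    ⟨ trans ⟩ *-cong (^ℤ-*-+ q≉0 a u) (^ℤ-homo-+ q≉0 (+ b ℤ.* v) Q ⟨ trans ⟩ *-congʳ (^ℤ-*-+ q≉0 b v)))
          recip : ∀ y L k → k ℕ.≤ L → recipPoch q ((y ℤ.+ + L) ℤ.- (y ℤ.+ + k)) ≈ qFactorial⁻¹ L * qFalling L k
          recip y L k k≤L = reflexive (P.cong (recipPoch q) ([a+k]-[a+j]≡k-j y (+ L) (+ k) ⟨ P.trans ⟩ +L-+a≡+[L∸a] k L k≤L))
                                    ⟨ trans ⟩ qFactorial⁻¹-∸ L k k≤L

        Φ-reindex : Φ r s y₁ y₂ y₃ ≈ shiftFactor * (IZ * IxN * IW * IxM)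
                                     * (pochℕ x (a ℕ.+ b) * qFactorial⁻¹ a * qFactorial⁻¹ b * tailZ a * tailW b)
        Φ-reindex = begin
          poch zwq (r ℤ.+ s) * recipPoch q (r ℤ.- y₁) * recipPoch zq (r ℤ.- y₂) * recipPoch zwq (r ℤ.- y₃)
            * recipPoch q (s ℤ.+ y₃) * recipPoch wq (s ℤ.+ y₂) * recipPoch zwq (s ℤ.+ y₁)
            ≈⟨ *-cong (*-cong (*-cong (*-cong (*-cong (*-cong g₁ g₂) g₃) g₄) g₅) g₆) g₇ ⟩
          (pc * pochℕ x (a ℕ.+ b)) * qFactorial⁻¹ a * (recipPoch zq u * (IZ * PZ)) * (rc * (IxN * PxN))
            * qFactorial⁻¹ b * (recipPoch wq v * (IW * PW)) * (rc * (IxM * PxM))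
            ≈⟨ solve 15 (λ pc pxab ia rzu iz pz rc ixn pxn ib rwv iw pw ixm pxm →
                   (pc :* pxab) :* ia :* (rzu :* (iz :* pz)) :* (rc :* (ixn :* pxn)) :* ib :* (rwv :* (iw :* pw)) :* (rc :* (ixm :* pxm))
                   := pc :* rzu :* rc :* rwv :* rc :* (iz :* ixn :* iw :* ixm) :* (pxab :* ia :* ib :* (pz :* pxn) :* (pw :* pxm))) refl
                 pc (pochℕ x (a ℕ.+ b)) (qFactorial⁻¹ a) (recipPoch zq u) IZ PZ rc IxN PxN (qFactorial⁻¹ b) (recipPoch wq v) IW PW IxM PxM ⟩
          shiftFactor * (IZ * IxN * IW * IxM) * (pochℕ x (a ℕ.+ b) * qFactorial⁻¹ a * qFactorial⁻¹ b * tailZ a * tailW b) ∎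
          where
          pc = poch zwq c′
          rc = recipPoch zwq c′
          PZ  = pochℕ (Z * q ^ℕ suc a) (N ℕ.∸ a)
          PxN = pochℕ (x * q ^ℕ a) (N ℕ.∸ a)
          PW  = pochℕ (W * q ^ℕ suc b) (M ℕ.∸ b)
          PxM = pochℕ (x * q ^ℕ b) (M ℕ.∸ b)
          g₁ : poch zwq (r ℤ.+ s) ≈ pc * pochℕ x (a ℕ.+ b)
          g₁ = reflexive (P.cong (poch zwq) ([y₁+k]+[y₁+y₂+j]≡c+[k+j] y₁ y₂ (+ a) (+ b) ⟨ P.trans ⟩ P.cong (λ t → c′ ℤ.+ t) (P.sym (ℤ.pos-+ a b))))
               ⟨ trans ⟩ poch-+ zwq-ok c′ (a ℕ.+ b) ⟨ trans ⟩ *-congˡ (pochℕ-cong (a ℕ.+ b) zwq*q^c′≈x)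
          g₂ : recipPoch q (r ℤ.- y₁) ≈ qFactorial⁻¹ a
          g₂ = reflexive (P.cong (recipPoch q) ([a+k]-a≡k y₁ (+ a)))
          g₃ : recipPoch zq (r ℤ.- y₂) ≈ recipPoch zq u * (IZ * PZ)
          g₃ = reflexive (P.cong (recipPoch zq) ([y₁+k]-y₂≡u+k y₁ y₂ (+ a)))
               ⟨ trans ⟩ recipPoch-+-extend zq-ok u a N a≤N
               ⟨ trans ⟩ *-congˡ (*-congˡ (pochℕ-cong (N ℕ.∸ a) (*-congʳ zq*q^u≈Z*q ⟨ trans ⟩ *-assoc _ _ _)))
          g₄ : recipPoch zwq (r ℤ.- y₃) ≈ rc * (IxN * PxN)
          g₄ = reflexive (P.cong (recipPoch zwq) ([y₁+k]-y₃≡c+k y₁ y₂ (+ a)))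
               ⟨ trans ⟩ recipPoch-+-extend zwq-ok c′ a N a≤N
               ⟨ trans ⟩ *-congˡ (*-congˡ (pochℕ-cong (N ℕ.∸ a) (*-congʳ zwq*q^c′≈x)))
          g₅ : recipPoch q (s ℤ.+ y₃) ≈ qFactorial⁻¹ b
          g₅ = reflexive (P.cong (recipPoch q) ([y₁+y₂+k]+y₃≡k y₁ y₂ (+ b)))
          g₆ : recipPoch wq (s ℤ.+ y₂) ≈ recipPoch wq v * (IW * PW)
          g₆ = reflexive (P.cong (recipPoch wq) ([y₁+y₂+k]+y₂≡v+k y₁ y₂ (+ b)))
               ⟨ trans ⟩ recipPoch-+-extend wq-ok v b M b≤M
               ⟨ trans ⟩ *-congˡ (*-congˡ (pochℕ-cong (M ℕ.∸ b) (*-congʳ wq*q^v≈W*q ⟨ trans ⟩ *-assoc _ _ _)))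
          g₇ : recipPoch zwq (s ℤ.+ y₁) ≈ rc * (IxM * PxM)
          g₇ = reflexive (P.cong (recipPoch zwq) ([y₁+y₂+k]+y₁≡c+k y₁ y₂ (+ b)))
               ⟨ trans ⟩ recipPoch-+-extend zwq-ok c′ b M b≤M
               ⟨ trans ⟩ *-congˡ (*-congˡ (pochℕ-cong (M ℕ.∸ b) (*-congʳ zwq*q^c′≈x)))

        𝒦Φ-reindex : 𝒦 n m r s * Φ r s y₁ y₂ y₃ ≈ prefactor * shiftFactor * normaliser * doubleSummand a b
        𝒦Φ-reindex = begin
          𝒦 n m r s * Φ r s y₁ y₂ y₃
            ≈⟨ *-cong 𝒦-reindex Φ-reindex ⟩
          prefactor * monomial a b * (qFactorial⁻¹ N * qFalling N a) * (qFactorial⁻¹ M * qFalling M b)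
            * (shiftFactor * (IZ * IxN * IW * IxM) * (pochℕ x (a ℕ.+ b) * qFactorial⁻¹ a * qFactorial⁻¹ b * tailZ a * tailW b))
            ≈⟨ solve 16 (λ p mo iN dN iM dM sf iz ixn iw ixm pxab ia ib tz tw →
                   p :* mo :* (iN :* dN) :* (iM :* dM) :* (sf :* (iz :* ixn :* iw :* ixm) :* (pxab :* ia :* ib :* tz :* tw))
                   := p :* sf :* (iN :* iz :* ixn :* iM :* iw :* ixm) :* ((dN :* ia) :* (dM :* ib) :* mo :* pxab :* tz :* tw)) refl
                 prefactor (monomial a b) (qFactorial⁻¹ N) (qFalling N a) (qFactorial⁻¹ M) (qFalling M b) shiftFactor
                 IZ IxN IW IxM (pochℕ x (a ℕ.+ b)) (qFactorial⁻¹ a) (qFactorial⁻¹ b) (tailZ a) (tailW b) ⟩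
          prefactor * shiftFactor * normaliser * doubleSummand a b ∎

      sum-identity : sumRange y₁ n (λ r → sumRange (y₁ ℤ.+ y₂) m (λ s → 𝒦 n m r s * Φ r s y₁ y₂ y₃))
                     ≈ z ^ℤ y₁ * w ^ℤ (y₁ ℤ.+ y₂) * q ^ℕ (halfSqExp y₁ y₂ y₃) * Φ n m y₁ y₂ y₃
      sum-identity = begin
        sumRange y₁ n (λ r → sumRange (y₁ ℤ.+ y₂) m (summand r))
          ≈⟨ sumRange-from y₁ N (λ r → sumRange (y₁ ℤ.+ y₂) m (summand r)) ⟩
        ∑< (suc N) (λ a → sumRange (y₁ ℤ.+ y₂) m (summand (y₁ ℤ.+ + a)))
          ≈⟨ ∑-cong (suc N) (λ a a≤N → sumRange-from (y₁ ℤ.+ y₂) M (summand (y₁ ℤ.+ + a))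
                                       ⟨ trans ⟩ ∑-cong (suc M) (λ b b≤M → 𝒦Φ-reindex a b (ℕ.≤-pred a≤N) (ℕ.≤-pred b≤M))) ⟩
        ∑< (suc N) (λ a → ∑< (suc M) (λ b → K * doubleSummand a b))
          ≈⟨ ∑-cong (suc N) (λ a _ → *-distribˡ-∑ K (doubleSummand a) (suc M)) ⟨
        ∑< (suc N) (λ a → K * ∑< (suc M) (doubleSummand a))
          ≈⟨ *-distribˡ-∑ K (λ a → ∑< (suc M) (doubleSummand a)) (suc N) ⟨
        K * ∑< (suc N) (λ a → ∑< (suc M) (doubleSummand a))
          ≈⟨ *-congˡ doubleSum-identity ⟩
        prefactor * shiftFactor * normaliser * pochℕ x (N ℕ.+ M)
          ≈⟨ solve 4 (λ p s d e → p :* s :* d :* e := p :* (s :* d :* e)) refl prefactor shiftFactor normaliser (pochℕ x (N ℕ.+ M)) ⟩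
        prefactor * (shiftFactor * normaliser * pochℕ x (N ℕ.+ M))
          ≈⟨ *-cong (*-congˡ (^ℤ-congʳ q (P.sym (halfSumOfSquares y₁ y₂)))) (sym Φ-corner) ⟩
        z ^ℤ y₁ * w ^ℤ (y₁ ℤ.+ y₂) * q ^ℕ (halfSqExp y₁ y₂ y₃) * Φ n m y₁ y₂ y₃ ∎
        where
        summand : ℤ → ℤ → Carrier
        summand r s = 𝒦 n m r s * Φ r s y₁ y₂ y₃
        K = prefactor * shiftFactor * normaliser

    Identity : ℤ → ℤ → ℤ → ℤ → ℤ → Set ℓ
    Identity n m y₁ y₂ y₃ =
      sumRange y₁ n (λ r → sumRange (y₁ ℤ.+ y₂) m (λ s → 𝒦 n m r s * Φ r s y₁ y₂ y₃))
      ≈ z ^ℤ y₁ * w ^ℤ (y₁ ℤ.+ y₂) * q ^ℕ (halfSqExp y₁ y₂ y₃) * Φ n m y₁ y₂ y₃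

    identity : ∀ n m y₁ y₂ → Identity n m y₁ y₂ (ℤ.- (y₁ ℤ.+ y₂))
    identity n m y₁ y₂ = by-cases (n ℤ.- y₁) P.refl (m ℤ.- (y₁ ℤ.+ y₂)) P.refl
      where
      y₃ = ℤ.- (y₁ ℤ.+ y₂)
      a+[b-a]≡b : ∀ a b → b ≡ a ℤ.+ (b ℤ.- a)
      a+[b-a]≡b = ZS.solve-∀
      by-cases : ∀ d → n ℤ.- y₁ ≡ d → ∀ e → m ℤ.- (y₁ ℤ.+ y₂) ≡ e → Identity n m y₁ y₂ y₃
      by-cases (+ N) n-y₁≡N (+ M) m-y₁-y₂≡M =
        P.subst₂ (λ n′ m′ → Identity n′ m′ y₁ y₂ y₃)
          (P.sym (a+[b-a]≡b y₁ n ⟨ P.trans ⟩ P.cong (λ t → y₁ ℤ.+ t) n-y₁≡N))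
          (P.sym (a+[b-a]≡b (y₁ ℤ.+ y₂) m ⟨ P.trans ⟩ P.cong (λ t → y₁ ℤ.+ y₂ ℤ.+ t) m-y₁-y₂≡M))
          (Shifted.sum-identity y₁ y₂ N M)
      by-cases -[1+ k ] n-y₁<0 _ _ =
        sumRange-empty y₁ n _ k n-y₁<0 ⟨ trans ⟩ sym (y≈0⇒x*y≈0 _ (Φ-vanishes-n n m y₁ y₂ y₃ k n-y₁<0))
      by-cases (+ N) _ -[1+ k ] m-y₁-y₂<0 =
        sumFrom≈∑ outer y₁ (rangeLength y₁ n)
        ⟨ trans ⟩ ∑-zero (rangeLength y₁ n) (λ i _ → sumRange-empty (y₁ ℤ.+ y₂) m (inner (y₁ ℤ.+ + i)) k m-y₁-y₂<0)
        ⟨ trans ⟩ sym (y≈0⇒x*y≈0 _ (Φ-vanishes-m n m y₁ y₂ y₃ k m-y₁-y₂<0))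
        where
        inner : ℤ → ℤ → Carrier
        inner r s = 𝒦 n m r s * Φ r s y₁ y₂ y₃
        outer : ℤ → Carrier
        outer r = sumRange (y₁ ℤ.+ y₂) m (inner r)

corollary4p5 : {c ℓ : Level} (F : Field c ℓ) (z w q : Field.Carrier F)
  → ¬ (Field._≈_ F z (Field.0# F))
  → ¬ (Field._≈_ F w (Field.0# F))
  → ¬ (Field._≈_ F q (Field.0# F))
  → (∀ (j : ℤ) → ¬ (j ≡ + 0) → ¬ (Field._≈_ F (Field._-_ F (Field.1# F) (QSeries._^ℤ_ F z w q q j)) (Field.0# F)))
  → (∀ (j : ℤ) → ¬ (Field._≈_ F (Field._-_ F (Field.1# F) (Field._*_ F z (QSeries._^ℤ_ F z w q q j))) (Field.0# F)))
  → (∀ (j : ℤ) → ¬ (Field._≈_ F (Field._-_ F (Field.1# F) (Field._*_ F w (QSeries._^ℤ_ F z w q q j))) (Field.0# F)))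
  → (∀ (j : ℤ) → ¬ (Field._≈_ F (Field._-_ F (Field.1# F) (Field._*_ F (Field._*_ F z w) (QSeries._^ℤ_ F z w q q j))) (Field.0# F)))
  → (n m y₁ y₂ y₃ : ℤ)
  → y₁ ℤ.+ y₂ ℤ.+ y₃ ≡ + 0
  → Field._≈_ F
      (QSeries.sumRange F z w q y₁ n (λ r →
        QSeries.sumRange F z w q (y₁ ℤ.+ y₂) m (λ s →
          Field._*_ F (QSeries.𝒦 F z w q n m r s) (QSeries.Φ F z w q r s y₁ y₂ y₃))))
      (Field._*_ F
        (Field._*_ F
          (Field._*_ F (QSeries._^ℤ_ F z w q z y₁) (QSeries._^ℤ_ F z w q w (y₁ ℤ.+ y₂)))
          (QSeries._^ℕ_ F z w q q (QSeries.halfSqExp F z w q y₁ y₂ y₃)))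
        (QSeries.Φ F z w q n m y₁ y₂ y₃))
corollary4p5 F z w q z≉0 w≉0 q≉0 1-q^j≉0 z-ok w-ok zw-ok n m y₁ y₂ y₃ y₁+y₂+y₃≡0 =
  P.subst (Identity n m y₁ y₂) (P.sym y₃≡-[y₁+y₂]) (identity n m y₁ y₂)
  where
  open MainIdentity.Hypotheses F z w q q≉0 1-q^j≉0 z≉0 w≉0 z-ok w-ok zw-ok
  y₃≡-[y₁+y₂] : y₃ ≡ ℤ.- (y₁ ℤ.+ y₂)
  y₃≡-[y₁+y₂] = y₃≡[y₁+y₂+y₃]-[y₁+y₂] y₁ y₂ y₃ ⟨ P.trans ⟩ P.cong (ℤ._- (y₁ ℤ.+ y₂)) y₁+y₂+y₃≡0 ⟨ P.trans ⟩ ℤ.+-identityˡ _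
    where
    y₃≡[y₁+y₂+y₃]-[y₁+y₂] : ∀ y₁ y₂ y₃ → y₃ ≡ y₁ ℤ.+ y₂ ℤ.+ y₃ ℤ.- (y₁ ℤ.+ y₂)
    y₃≡[y₁+y₂+y₃]-[y₁+y₂] = ZS.solve-∀
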